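{- Let $k$ be a finite field of odd characteristic $\ell$ and let $G \subset \mathrm{GL}_2(k)$ be a subgroup whose image $\overline{G}$ in $\mathrm{PGL}_2(k)$ is isomorphic to $A_4$. Then the image of the trace map on the commutator subgroup $[G,G]$ equals $\{0, 2, -2\}$. -}

module Defs where

open import Level using (Level; _⊔_)
open import Algebra.Bundles using (CommutativeRing)
open import Data.Nat as ℕ using (ℕ; _%_)
open import Data.Fin as Fin using (Fin; _<_)
open import Data.Fin.Properties using (_<?_)
open import Data.List using (List; length; filter; allFin; concatMap; map)
open import Data.Sum using (_⊎_)
open import Data.Product using (Σ; ∃; _×_; _,_)
open import Function.Definitions using (Injective)
open import Relation.Binary.PropositionalEquality using (_≡_)
open import Relation.Nullary using (¬_)

record IsField {c ℓ} (R : CommutativeRing c ℓ) : Set (c ⊔ ℓ) where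
  open CommutativeRing R
  field
    1≉0     : ¬ (1# ≈ 0#)
    inverse : ∀ x → ¬ (x ≈ 0#) → ∃ λ y → (x * y) ≈ 1#

IsFinite : ∀ {c ℓ} (R : CommutativeRing c ℓ) → Set (c ⊔ ℓ)
IsFinite R = ∃ λ (n : ℕ) → Σ (Fin n → Carrier) λ e → ∀ x → ∃ λ i → e i ≈ x
  where open CommutativeRing R

-- Odd characteristic: 2 ≠ 0.  (A finite field has prime characteristic ℓ,
-- and ℓ is odd iff 1 + 1 ≉ 0.)
OddChar : ∀ {c ℓ} (R : CommutativeRing c ℓ) → Set ℓ
OddChar R = ¬ ((1# + 1#) ≈ 0#)
  where open CommutativeRing R

module Matrices {c ℓ} (R : CommutativeRing c ℓ) where
  open CommutativeRing R

  record M2 : Set c where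
    constructor mat
    field a b c' d : Carrier
  open M2 public

  _≈M_ : M2 → M2 → Set ℓ
  m ≈M n = (a m ≈ a n) × (b m ≈ b n) × (c' m ≈ c' n) × (d m ≈ d n)

  _·_ : M2 → M2 → M2
  m · n = mat (a m * a n + b m * c' n) (a m * b n + b m * d n)
              (c' m * a n + d m * c' n) (c' m * b n + d m * d n)

  I : M2
  I = mat 1# 0# 0# 1#

  det : M2 → Carrier
  det m = a m * d m - b m * c' m

  tr : M2 → Carrier
  tr m = a m + d m

  IsScalar : M2 → Set (c ⊔ ℓ)
  IsScalar m = ∃ λ x → m ≈M mat x 0# 0# x

  InGL2 : M2 → Set ℓ
  InGL2 m = ¬ (det m ≈ 0#)

  record IsSubgroupGL2 {p} (G : M2 → Set p) : Set (c ⊔ ℓ ⊔ p) where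
    field
      resp  : ∀ {x y} → x ≈M y → G x → G y
      inGL  : ∀ {x} → G x → InGL2 x
      one   : G I
      mul   : ∀ {x y} → G x → G y → G (x · y)
      inv   : ∀ {x} → G x → ∃ λ y → G y × (x · y) ≈M I

  data Comm {p} (G : M2 → Set p) : M2 → Set (c ⊔ ℓ ⊔ p) where
    gen  : ∀ {x x' y y'} → G x → G x' → G y → G y' →
           (x · x') ≈M I → (y · y') ≈M I → Comm G (((x · y) · x') · y')
    one  : Comm G I
    mul  : ∀ {x y} → Comm G x → Comm G y → Comm G (x · y)
    inv  : ∀ {x y} → Comm G x → (x · y) ≈M I → Comm G y
    resp : ∀ {x y} → x ≈M y → Comm G x → Comm G y

  InTraceImageComm : ∀ {p} (G : M2 → Set p) → Carrier → Set (c ⊔ ℓ ⊔ p)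
  InTraceImageComm G t = ∃ λ x → Comm G x × (tr x ≈ t)

  In0±2 : Carrier → Set ℓ
  In0±2 t = (t ≈ 0#) ⊎ (t ≈ (1# + 1#)) ⊎ (t ≈ - (1# + 1#))

Perm4 : Set
Perm4 = Fin 4 → Fin 4

_≗4_ : Perm4 → Perm4 → Set
f ≗4 g = ∀ i → f i ≡ g i

inversions : Perm4 → ℕ
inversions f = length (filter (λ (p : Fin 4 × Fin 4) → let (i , j) = p in
                                 Relation.Nullary.Decidable._×-dec_ (i <? j) (f j <? f i))
                              (concatMap (λ i → map (λ j → (i , j)) (allFin 4)) (allFin 4)))
  where import Relation.Nullary.Decidable

InA4 : Perm4 → Set
InA4 f = Injective _≡_ _≡_ f × (inversions f % 2 ≡ 0)

-- "The image of G in PGL₂(k) is isomorphic to A₄", expressed without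
-- quotient types via the first isomorphism theorem: there is a group
-- homomorphism φ : G → A₄ which is surjective and whose kernel is exactly
-- G ∩ {scalar matrices} (the kernel of G → PGL₂(k)).

module _ {c ℓ} (R : CommutativeRing c ℓ) where
  open Matrices R

  record ImageInPGL2IsA4 {p} (G : M2 → Set p) : Set (c ⊔ ℓ ⊔ p) where
    field
      φ        : ∀ x → G x → Perm4
      φ-A4     : ∀ x (gx : G x) → InA4 (φ x gx)
      φ-resp   : ∀ {x y} (gx : G x) (gy : G y) → x ≈M y → φ x gx ≗4 φ y gy
      φ-hom    : ∀ {x y} (gx : G x) (gy : G y) (gxy : G (x · y)) →
                 φ (x · y) gxy ≗4 (λ i → φ x gx (φ y gy i))
      φ-surj   : ∀ σ → InA4 σ → ∃ λ x → Σ (G x) λ gx → φ x gx ≗4 σ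
      φ-kernel : ∀ x (gx : G x) → (φ x gx ≗4 (λ i → i)) → IsScalar x
      φ-scalar : ∀ x (gx : G x) → IsScalar x → φ x gx ≗4 (λ i → i)

{-# OPTIONS --safe #-}

-- Let φ : G → A₄ be the surjection with scalar kernel, and lift the 3-cycle z and the double
-- transposition q to Z, T ∈ G. The commutator X = [Z, T] has determinant 1 and lies over a double
-- transposition, so X² is scalar but X is not; hence tr X = 0 and X² = -1, realising the traces 0 and -2
-- (and 2 = tr 1). Conversely, with Y = Z X Z⁻¹ one finds Z Y Z⁻¹ = μ XY where μ² = 1, and i = μX, j = μY
-- satisfy i² = j² = -1, ji = -ij, Z i Z⁻¹ = j and Z j Z⁻¹ = ij. Since A₄ = V₄ ⋊ ⟨z⟩, every element of G is
-- a scalar multiple of iˣ jʸ Zᵉ, so every commutator in G, and hence all of [G, G], lies in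
-- Q₈ = {±1, ±i, ±j, ±ij}, whose traces are ±2 and 0. Equality in k is not decidable, so the elements of
-- Q₈ carry explicit Boolean signs.

module Submission where

open import Defs
open import Algebra.Bundles using (CommutativeRing; Monoid)
open import Data.Bool using (Bool; true; false; if_then_else_; _xor_; _∧_)
open import Data.Bool.Properties using (xor-same)
open import Data.Integer as ℤ using (ℤ; +_; -[1+_])
import Data.Integer.Properties as ℤ
open import Data.Maybe using (Maybe; just; nothing)
open import Data.Nat as ℕ using (ℕ; zero; suc)
import Data.Nat.Properties as ℕ
open import Data.Product using (Σ; ∃; _×_; _,_; proj₁; proj₂)
open import Data.Sum as Sum using (inj₁; inj₂)
open import Function using (_∘_)
open import Function.Bundles using (_⇔_; mk⇔)
open import Level using (_⊔_)
open import Relation.Binary.PropositionalEquality as ≡ using (_≡_)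
open import Relation.Binary.Structures using (IsEquivalence)
open import Relation.Nullary using (¬_; yes; no)
open import Relation.Nullary.Decidable using (from-yes; from-no)
import Algebra.Solver.Ring.AlmostCommutativeRing as ACR

module MonoidProperties {a ℓ} (M : Monoid a ℓ) where
  open Monoid M
  open import Algebra.Properties.Monoid M
  open import Relation.Binary.Reasoning.Setoid setoid

  inverse-unique : ∀ {l x r} → l ∙ x ≈ ε → x ∙ r ≈ ε → r ≈ l
  inverse-unique {l} {x} {r} lx≈ε xr≈ε = begin
    r             ≈⟨ identityˡ r ⟨
    ε ∙ r         ≈⟨ ∙-congʳ lx≈ε ⟨
    (l ∙ x) ∙ r   ≈⟨ assoc l x r ⟩
    l ∙ (x ∙ r)   ≈⟨ ∙-congˡ xr≈ε ⟩
    l ∙ ε         ≈⟨ identityʳ l ⟩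
    l             ∎

  infixr 30 _^_
  _^_ : Carrier → ℕ → Carrier
  x ^ zero  = ε
  x ^ suc n = x ∙ x ^ n

  infixr 30 _^ᵇ_
  _^ᵇ_ : Carrier → Bool → Carrier
  x ^ᵇ b = if b then x else ε

  ^-+ : ∀ x m n → x ^ (m ℕ.+ n) ≈ x ^ m ∙ x ^ n
  ^-+ x zero    n = sym (identityˡ _)
  ^-+ x (suc m) n = trans (∙-congˡ (^-+ x m n)) (sym (assoc _ _ _))

  ^-comm : ∀ x m n → x ^ m ∙ x ^ n ≈ x ^ n ∙ x ^ m
  ^-comm x m n = begin
    x ^ m ∙ x ^ n     ≈⟨ ^-+ x m n ⟨
    x ^ (m ℕ.+ n)     ≡⟨ ≡.cong (x ^_) (ℕ.+-comm m n) ⟩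
    x ^ (n ℕ.+ m)     ≈⟨ ^-+ x n m ⟩
    x ^ n ∙ x ^ m     ∎

  ∙-^-comm : ∀ x n → x ∙ x ^ n ≈ x ^ n ∙ x
  ∙-^-comm x zero    = trans (identityʳ x) (sym (identityˡ x))
  ∙-^-comm x (suc n) = trans (∙-congˡ (∙-^-comm x n)) (sym (assoc x (x ^ n) x))

  ^-inverse : ∀ {x y} → x ∙ y ≈ ε → ∀ n → x ^ n ∙ y ^ n ≈ ε
  ^-inverse xy≈ε zero    = identityˡ ε
  ^-inverse {x} {y} xy≈ε (suc n) = begin
    (x ∙ x ^ n) ∙ (y ∙ y ^ n)   ≈⟨ ∙-congˡ (∙-^-comm y n) ⟩
    (x ∙ x ^ n) ∙ (y ^ n ∙ y)   ≈⟨ uv≈w⇒xu∙vy≈x∙wy (^-inverse xy≈ε n) x y ⟩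
    x ∙ (ε ∙ y)                 ≈⟨ ∙-congˡ (identityˡ y) ⟩
    x ∙ y                       ≈⟨ xy≈ε ⟩
    ε                           ∎

  intertwine-∙ : ∀ {g m m' n n'} → g ∙ m ≈ m' ∙ g → g ∙ n ≈ n' ∙ g → g ∙ (m ∙ n) ≈ (m' ∙ n') ∙ g
  intertwine-∙ {g} {m} {m'} {n} {n'} gm gn = begin
    g ∙ (m ∙ n)     ≈⟨ assoc g m n ⟨
    (g ∙ m) ∙ n     ≈⟨ ∙-congʳ gm ⟩
    (m' ∙ g) ∙ n    ≈⟨ assoc m' g n ⟩
    m' ∙ (g ∙ n)    ≈⟨ ∙-congˡ gn ⟩
    m' ∙ (n' ∙ g)   ≈⟨ assoc m' n' g ⟨
    (m' ∙ n') ∙ g   ∎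

  NormalisedBy : ∀ {p} → (Carrier → Set p) → Carrier → Set (a ⊔ ℓ ⊔ p)
  NormalisedBy P g = ∀ {m} → P m → ∃ λ m' → P m' × g ∙ m ≈ m' ∙ g

  ^-normalises : ∀ {p} {P : Carrier → Set p} {g} → NormalisedBy P g → ∀ n → NormalisedBy P (g ^ n)
  ^-normalises g-norm zero    {m} Pm = m , Pm , trans (identityˡ m) (sym (identityʳ m))
  ^-normalises {g = g} g-norm (suc n) {m} Pm =
    let (m₁ , Pm₁ , gⁿm≈m₁gⁿ) = ^-normalises g-norm n Pm
        (m₂ , Pm₂ , gm₁≈m₂g) = g-norm Pm₁
    in m₂ , Pm₂ , (begin
      (g ∙ g ^ n) ∙ m       ≈⟨ assoc g (g ^ n) m ⟩
      g ∙ (g ^ n ∙ m)       ≈⟨ ∙-congˡ gⁿm≈m₁gⁿ ⟩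
      g ∙ (m₁ ∙ g ^ n)      ≈⟨ assoc g m₁ (g ^ n) ⟨
      (g ∙ m₁) ∙ g ^ n      ≈⟨ ∙-congʳ gm₁≈m₂g ⟩
      (m₂ ∙ g) ∙ g ^ n      ≈⟨ assoc m₂ g (g ^ n) ⟩
      m₂ ∙ (g ∙ g ^ n)      ∎)

  twisted-commutator : ∀ {U P V R P' U' R' V' V₁ U₁} →
                       P ∙ V ≈ V₁ ∙ P → R ∙ U' ≈ U₁ ∙ R → P ∙ R ≈ R ∙ P → P ∙ P' ≈ ε → R ∙ R' ≈ ε →
                       (((U ∙ P) ∙ (V ∙ R)) ∙ (P' ∙ U')) ∙ (R' ∙ V') ≈ U ∙ (V₁ ∙ (U₁ ∙ V'))
  twisted-commutator {U} {P} {V} {R} {P'} {U'} {R'} {V'} {V₁} {U₁} PV RU' PR PP' RR' = begin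
    (((U ∙ P) ∙ (V ∙ R)) ∙ (P' ∙ U')) ∙ (R' ∙ V')     ≈⟨ right-nested ⟩
    U ∙ (P ∙ (V ∙ (R ∙ (P' ∙ (U' ∙ (R' ∙ V'))))))     ≈⟨ ∙-congˡ (uv≈wx⇒u∙vy≈w∙xy PV _) ⟩
    U ∙ (V₁ ∙ (P ∙ (R ∙ (P' ∙ (U' ∙ (R' ∙ V'))))))    ≈⟨ ∙-congˡ (∙-congˡ (uv≈wx⇒u∙vy≈w∙xy PR _)) ⟩
    U ∙ (V₁ ∙ (R ∙ (P ∙ (P' ∙ (U' ∙ (R' ∙ V'))))))    ≈⟨ ∙-congˡ (∙-congˡ (∙-congˡ (cancelˡ PP' _))) ⟩
    U ∙ (V₁ ∙ (R ∙ (U' ∙ (R' ∙ V'))))                 ≈⟨ ∙-congˡ (∙-congˡ (uv≈wx⇒u∙vy≈w∙xy RU' _)) ⟩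
    U ∙ (V₁ ∙ (U₁ ∙ (R ∙ (R' ∙ V'))))                 ≈⟨ ∙-congˡ (∙-congˡ (∙-congˡ (cancelˡ RR' V'))) ⟩
    U ∙ (V₁ ∙ (U₁ ∙ V'))                              ∎
    where
    right-nested : (((U ∙ P) ∙ (V ∙ R)) ∙ (P' ∙ U')) ∙ (R' ∙ V') ≈ U ∙ (P ∙ (V ∙ (R ∙ (P' ∙ (U' ∙ (R' ∙ V'))))))
    right-nested = begin
      (((U ∙ P) ∙ (V ∙ R)) ∙ (P' ∙ U')) ∙ (R' ∙ V')     ≈⟨ assoc _ _ _ ⟩
      ((U ∙ P) ∙ (V ∙ R)) ∙ ((P' ∙ U') ∙ (R' ∙ V'))     ≈⟨ assoc _ _ _ ⟩
      (U ∙ P) ∙ ((V ∙ R) ∙ ((P' ∙ U') ∙ (R' ∙ V')))     ≈⟨ assoc _ _ _ ⟩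
      U ∙ (P ∙ ((V ∙ R) ∙ ((P' ∙ U') ∙ (R' ∙ V'))))     ≈⟨ ∙-congˡ (∙-congˡ (assoc _ _ _)) ⟩
      U ∙ (P ∙ (V ∙ (R ∙ ((P' ∙ U') ∙ (R' ∙ V')))))     ≈⟨ ∙-congˡ (∙-congˡ (∙-congˡ (∙-congˡ (assoc _ _ _)))) ⟩
      U ∙ (P ∙ (V ∙ (R ∙ (P' ∙ (U' ∙ (R' ∙ V'))))))     ∎

-- Algebra.Solver.Ring needs coefficients with decidable equality; ℤ has it and maps into every ring.
module IntegerCoefficientSolver {c ℓ} (R : CommutativeRing c ℓ) where
  open CommutativeRing R
  open import Algebra.Properties.Ring ring using (-‿involutive; -‿distribˡ-*; -‿distribʳ-*; -‿+-comm; -0#≈0#)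
  open import Relation.Binary.Reasoning.Setoid setoid

  -- fromℕ 1 is 1# on the nose, so that the solver constant con (+ 1) is definitionally 1#.
  fromℕ : ℕ → Carrier
  fromℕ zero          = 0#
  fromℕ (suc zero)    = 1#
  fromℕ (suc (suc n)) = 1# + fromℕ (suc n)

  fromℕ-suc : ∀ n → fromℕ (suc n) ≈ 1# + fromℕ n
  fromℕ-suc zero    = sym (+-identityʳ 1#)
  fromℕ-suc (suc n) = refl

  fromℤ : ℤ → Carrier
  fromℤ (+ n)     = fromℕ n
  fromℤ -[1+ n ]  = - fromℕ (suc n)

  fromℕ-+ : ∀ m n → fromℕ (m ℕ.+ n) ≈ fromℕ m + fromℕ n
  fromℕ-+ zero    n = sym (+-identityˡ _)
  fromℕ-+ (suc m) n = begin
    fromℕ (suc (m ℕ.+ n))          ≈⟨ fromℕ-suc (m ℕ.+ n) ⟩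
    1# + fromℕ (m ℕ.+ n)           ≈⟨ +-congˡ (fromℕ-+ m n) ⟩
    1# + (fromℕ m + fromℕ n)       ≈⟨ +-assoc _ _ _ ⟨
    (1# + fromℕ m) + fromℕ n       ≈⟨ +-congʳ (fromℕ-suc m) ⟨
    fromℕ (suc m) + fromℕ n        ∎

  fromℕ-* : ∀ m n → fromℕ (m ℕ.* n) ≈ fromℕ m * fromℕ n
  fromℕ-* zero    n = sym (zeroˡ _)
  fromℕ-* (suc m) n = begin
    fromℕ (n ℕ.+ m ℕ.* n)          ≈⟨ fromℕ-+ n (m ℕ.* n) ⟩
    fromℕ n + fromℕ (m ℕ.* n)      ≈⟨ +-cong (sym (*-identityˡ _)) (fromℕ-* m n) ⟩
    1# * fromℕ n + fromℕ m * fromℕ n ≈⟨ distribʳ _ _ _ ⟨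
    (1# + fromℕ m) * fromℕ n        ≈⟨ *-congʳ (fromℕ-suc m) ⟨
    fromℕ (suc m) * fromℕ n         ∎

  fromℤ-⊖ : ∀ m n → fromℤ (m ℤ.⊖ n) ≈ fromℕ m - fromℕ n
  fromℤ-⊖ zero    zero    = sym (-‿inverseʳ _)
  fromℤ-⊖ (suc m) zero    = sym (trans (+-congˡ -0#≈0#) (+-identityʳ _))
  fromℤ-⊖ zero    (suc n) = sym (+-identityˡ _)
  fromℤ-⊖ (suc m) (suc n) = begin
    fromℤ (suc m ℤ.⊖ suc n)             ≡⟨ ≡.cong fromℤ (ℤ.[1+m]⊖[1+n]≡m⊖n m n) ⟩
    fromℤ (m ℤ.⊖ n)                     ≈⟨ fromℤ-⊖ m n ⟩
    fromℕ m - fromℕ n                   ≈⟨ +-congʳ (+-identityˡ _) ⟨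
    (0# + fromℕ m) - fromℕ n            ≈⟨ +-congʳ (+-congʳ (-‿inverseʳ 1#)) ⟨
    ((1# - 1#) + fromℕ m) - fromℕ n     ≈⟨ +-congʳ (+-assoc _ _ _) ⟩
    (1# + (- 1# + fromℕ m)) - fromℕ n   ≈⟨ +-congʳ (+-congˡ (+-comm _ _)) ⟩
    (1# + (fromℕ m - 1#)) - fromℕ n     ≈⟨ +-congʳ (+-assoc _ _ _) ⟨
    ((1# + fromℕ m) - 1#) - fromℕ n     ≈⟨ +-assoc _ _ _ ⟩
    (1# + fromℕ m) + (- 1# - fromℕ n)   ≈⟨ +-congˡ (-‿+-comm _ _) ⟩
    (1# + fromℕ m) - (1# + fromℕ n)     ≈⟨ +-cong (fromℕ-suc m) (-‿cong (fromℕ-suc n)) ⟨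
    fromℕ (suc m) - fromℕ (suc n)       ∎

  fromℤ-+ : ∀ i j → fromℤ (i ℤ.+ j) ≈ fromℤ i + fromℤ j
  fromℤ-+ (+ m)    (+ n)    = fromℕ-+ m n
  fromℤ-+ (+ m)    -[1+ n ] = fromℤ-⊖ m (suc n)
  fromℤ-+ -[1+ m ] (+ n)    = trans (fromℤ-⊖ n (suc m)) (+-comm _ _)
  fromℤ-+ -[1+ m ] -[1+ n ] = begin
    - fromℕ (suc (suc (m ℕ.+ n)))        ≡⟨ ≡.cong (λ k → - fromℕ (suc k)) (ℕ.+-suc m n) ⟨
    - fromℕ (suc m ℕ.+ suc n)            ≈⟨ -‿cong (fromℕ-+ (suc m) (suc n)) ⟩
    - (fromℕ (suc m) + fromℕ (suc n))    ≈⟨ -‿+-comm _ _ ⟨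
    - fromℕ (suc m) - fromℕ (suc n)      ∎

  fromℤ-neg : ∀ i → fromℤ (ℤ.- i) ≈ - fromℤ i
  fromℤ-neg -[1+ n ]      = sym (-‿involutive _)
  fromℤ-neg (+ zero)      = sym -0#≈0#
  fromℤ-neg (+ (suc n))   = refl

  fromℤ-* : ∀ i j → fromℤ (i ℤ.* j) ≈ fromℤ i * fromℤ j
  fromℤ-* (+ m) (+ n) = begin
    fromℤ (+ m ℤ.* + n)   ≡⟨ ≡.cong fromℤ (ℤ.+◃n≡+n (m ℕ.* n)) ⟩
    fromℕ (m ℕ.* n)       ≈⟨ fromℕ-* m n ⟩
    fromℕ m * fromℕ n     ∎
  fromℤ-* (+ m) -[1+ n ] = begin
    fromℤ (+ m ℤ.* -[1+ n ])          ≡⟨ ≡.cong fromℤ (ℤ.-◃n≡-n (m ℕ.* suc n)) ⟩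
    fromℤ (ℤ.- (+ (m ℕ.* suc n)))     ≈⟨ fromℤ-neg (+ (m ℕ.* suc n)) ⟩
    - fromℕ (m ℕ.* suc n)             ≈⟨ -‿cong (fromℕ-* m (suc n)) ⟩
    - (fromℕ m * fromℕ (suc n))       ≈⟨ -‿distribʳ-* _ _ ⟩
    fromℕ m * - fromℕ (suc n)         ∎
  fromℤ-* -[1+ m ] (+ n) = begin
    fromℤ (-[1+ m ] ℤ.* + n)          ≡⟨ ≡.cong fromℤ (ℤ.-◃n≡-n (suc m ℕ.* n)) ⟩
    fromℤ (ℤ.- (+ (suc m ℕ.* n)))     ≈⟨ fromℤ-neg (+ (suc m ℕ.* n)) ⟩
    - fromℕ (suc m ℕ.* n)             ≈⟨ -‿cong (fromℕ-* (suc m) n) ⟩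
    - (fromℕ (suc m) * fromℕ n)       ≈⟨ -‿distribˡ-* _ _ ⟩
    - fromℕ (suc m) * fromℕ n         ∎
  fromℤ-* -[1+ m ] -[1+ n ] = begin
    fromℕ (suc m ℕ.* suc n)                ≈⟨ fromℕ-* (suc m) (suc n) ⟩
    fromℕ (suc m) * fromℕ (suc n)          ≈⟨ -‿involutive _ ⟨
    - - (fromℕ (suc m) * fromℕ (suc n))    ≈⟨ -‿cong (-‿distribˡ-* _ _) ⟩
    - (- fromℕ (suc m) * fromℕ (suc n))    ≈⟨ -‿distribʳ-* _ _ ⟩
    - fromℕ (suc m) * - fromℕ (suc n)      ∎

  private
    homomorphism : CommutativeRing.rawRing ℤ.+-*-commutativeRing ACR.-Raw-AlmostCommutative⟶ ACR.fromCommutativeRing R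
    homomorphism = record
      { ⟦_⟧ = fromℤ ; +-homo = fromℤ-+ ; *-homo = fromℤ-* ; -‿homo = fromℤ-neg ; 0-homo = refl ; 1-homo = refl }

    weaklyDecide : ∀ i j → Maybe (fromℤ i ≈ fromℤ j)
    weaklyDecide i j with i ℤ.≟ j
    ... | yes ≡.refl = just refl
    ... | no _       = nothing

  open import Algebra.Solver.Ring _ _ homomorphism weaklyDecide public

module MatrixProperties {c ℓ} (R : CommutativeRing c ℓ) where
  open CommutativeRing R
  open Matrices R
  open IntegerCoefficientSolver R using (solve; _:+_; _:*_; _:-_; :-_; _:=_; con)

  ⟨_⟩ : Carrier → M2
  ⟨ s ⟩ = mat s 0# 0# s

  -I : M2
  -I = ⟨ - 1# ⟩

  M2-monoid : Monoid c ℓ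
  M2-monoid = record
    { Carrier = M2 ; _≈_ = _≈M_ ; _∙_ = _·_ ; ε = I
    ; isMonoid = record
      { isSemigroup = record
        { isMagma = record { isEquivalence = isEquivalenceM ; ∙-cong = ·-cong }
        ; assoc = ·-assoc }
      ; identity = ·-identityˡ , ·-identityʳ } }
    where
    isEquivalenceM : IsEquivalence _≈M_
    isEquivalenceM = record
      { refl  = refl , refl , refl , refl
      ; sym   = λ (p , q , r , s) → sym p , sym q , sym r , sym s
      ; trans = λ (p , q , r , s) (p' , q' , r' , s') → trans p p' , trans q q' , trans r r' , trans s s' }

    ·-cong : ∀ {m m' n n'} → m ≈M m' → n ≈M n' → (m · n) ≈M (m' · n')
    ·-cong (p , q , r , s) (p' , q' , r' , s') =
      +-cong (*-cong p p') (*-cong q r') , +-cong (*-cong p q') (*-cong q s') ,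
      +-cong (*-cong r p') (*-cong s r') , +-cong (*-cong r q') (*-cong s s')

    entry-assoc : ∀ p q a b c d x y →
                  (p * a + q * c) * x + (p * b + q * d) * y ≈ p * (a * x + b * y) + q * (c * x + d * y)
    entry-assoc = solve 8 (λ p q a b c d x y →
      (p :* a :+ q :* c) :* x :+ (p :* b :+ q :* d) :* y := p :* (a :* x :+ b :* y) :+ q :* (c :* x :+ d :* y)) refl

    ·-assoc : ∀ l m n → ((l · m) · n) ≈M (l · (m · n))
    ·-assoc (mat a₁ b₁ c₁ d₁) (mat a₂ b₂ c₂ d₂) (mat a₃ b₃ c₃ d₃) =
      entry-assoc a₁ b₁ a₂ b₂ c₂ d₂ a₃ c₃ , entry-assoc a₁ b₁ a₂ b₂ c₂ d₂ b₃ d₃ ,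
      entry-assoc c₁ d₁ a₂ b₂ c₂ d₂ a₃ c₃ , entry-assoc c₁ d₁ a₂ b₂ c₂ d₂ b₃ d₃

    first : ∀ x y → 1# * x + 0# * y ≈ x
    first = solve 2 (λ x y → con (+ 1) :* x :+ con (+ 0) :* y := x) refl

    second : ∀ x y → 0# * x + 1# * y ≈ y
    second = solve 2 (λ x y → con (+ 0) :* x :+ con (+ 1) :* y := y) refl

    ·-identityˡ : ∀ m → (I · m) ≈M m
    ·-identityˡ (mat a b c d) = first a c , first b d , second a c , second b d

    ·-identityʳ : ∀ m → (m · I) ≈M m
    ·-identityʳ (mat a b c d) =
      trans (+-cong (*-comm _ _) (*-comm _ _)) (first a b) , trans (+-cong (*-comm _ _) (*-comm _ _)) (second a b) ,
      trans (+-cong (*-comm _ _) (*-comm _ _)) (first c d) , trans (+-cong (*-comm _ _) (*-comm _ _)) (second c d)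

  module M = Monoid M2-monoid

  open import Algebra.Properties.Group +-group using (inverseˡ-unique)

  ⟨⟩-cong : ∀ {s t} → s ≈ t → ⟨ s ⟩ ≈M ⟨ t ⟩
  ⟨⟩-cong e = e , refl , refl , e

  private
    scaleˡ : ∀ s x y → s * x + 0# * y ≈ s * x
    scaleˡ = solve 3 (λ s x y → s :* x :+ con (+ 0) :* y := s :* x) refl

    scaleʳ : ∀ s x y → 0# * y + s * x ≈ s * x
    scaleʳ = solve 3 (λ s x y → con (+ 0) :* y :+ s :* x := s :* x) refl

    scaleˡ' : ∀ s x y → x * s + y * 0# ≈ s * x
    scaleˡ' = solve 3 (λ s x y → x :* s :+ y :* con (+ 0) := s :* x) refl

    scaleʳ' : ∀ s x y → y * 0# + x * s ≈ s * x
    scaleʳ' = solve 3 (λ s x y → y :* con (+ 0) :+ x :* s := s :* x) refl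

  ⟨⟩-·ˡ : ∀ s m → (⟨ s ⟩ · m) ≈M mat (s * a m) (s * b m) (s * c' m) (s * d m)
  ⟨⟩-·ˡ s (mat a b c d) = scaleˡ s a c , scaleˡ s b d , scaleʳ s c a , scaleʳ s d b

  ⟨⟩-·ʳ : ∀ s m → (m · ⟨ s ⟩) ≈M mat (s * a m) (s * b m) (s * c' m) (s * d m)
  ⟨⟩-·ʳ s (mat a b c d) = scaleˡ' s a b , scaleʳ' s b a , scaleˡ' s c d , scaleʳ' s d c

  ⟨⟩-central : ∀ s m → (⟨ s ⟩ · m) ≈M (m · ⟨ s ⟩)
  ⟨⟩-central s m = M.trans (⟨⟩-·ˡ s m) (M.sym (⟨⟩-·ʳ s m))

  ⟨⟩-·-⟨⟩ : ∀ s t → (⟨ s ⟩ · ⟨ t ⟩) ≈M ⟨ s * t ⟩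
  ⟨⟩-·-⟨⟩ s t = scaleˡ s t 0# , trans (scaleˡ s 0# t) (zeroʳ s) , trans (scaleʳ s 0# t) (zeroʳ s) , scaleʳ s t 0#

  det-cong : ∀ {m n} → m ≈M n → det m ≈ det n
  det-cong (p , q , r , s) = +-cong (*-cong p s) (-‿cong (*-cong q r))

  tr-cong : ∀ {m n} → m ≈M n → tr m ≈ tr n
  tr-cong (p , _ , _ , s) = +-cong p s

  det-· : ∀ m n → det (m · n) ≈ det m * det n
  det-· (mat a₁ b₁ c₁ d₁) (mat a₂ b₂ c₂ d₂) = binet a₁ b₁ c₁ d₁ a₂ b₂ c₂ d₂
    where
    binet : ∀ a₁ b₁ c₁ d₁ a₂ b₂ c₂ d₂ →
            (a₁ * a₂ + b₁ * c₂) * (c₁ * b₂ + d₁ * d₂) - (a₁ * b₂ + b₁ * d₂) * (c₁ * a₂ + d₁ * c₂)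
            ≈ (a₁ * d₁ - b₁ * c₁) * (a₂ * d₂ - b₂ * c₂)
    binet = solve 8 (λ a₁ b₁ c₁ d₁ a₂ b₂ c₂ d₂ →
      (a₁ :* a₂ :+ b₁ :* c₂) :* (c₁ :* b₂ :+ d₁ :* d₂) :- (a₁ :* b₂ :+ b₁ :* d₂) :* (c₁ :* a₂ :+ d₁ :* c₂)
      := (a₁ :* d₁ :- b₁ :* c₁) :* (a₂ :* d₂ :- b₂ :* c₂)) refl

  det-⟨⟩ : ∀ s → det ⟨ s ⟩ ≈ s * s
  det-⟨⟩ = solve 1 (λ s → s :* s :- con (+ 0) :* con (+ 0) := s :* s) refl

  tr-⟨⟩· : ∀ s m → tr (⟨ s ⟩ · m) ≈ s * tr m
  tr-⟨⟩· s m = trans (tr-cong (⟨⟩-·ˡ s m)) (sym (distribˡ s (a m) (d m)))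

  cayley-hamilton : ∀ m → (m · m) ≈M mat (tr m * a m - det m) (tr m * b m) (tr m * c' m) (tr m * d m - det m)
  cayley-hamilton (mat a b c d) = ch₁ a b c d , ch₂ a b c d , ch₃ a b c d , ch₄ a b c d
    where
    ch₁ : ∀ a b c d → a * a + b * c ≈ (a + d) * a - (a * d - b * c)
    ch₁ = solve 4 (λ a b c d → a :* a :+ b :* c := (a :+ d) :* a :- (a :* d :- b :* c)) refl
    ch₂ : ∀ a b c d → a * b + b * d ≈ (a + d) * b
    ch₂ = solve 4 (λ a b c d → a :* b :+ b :* d := (a :+ d) :* b) refl
    ch₃ : ∀ a b c d → c * a + d * c ≈ (a + d) * c
    ch₃ = solve 4 (λ a b c d → c :* a :+ d :* c := (a :+ d) :* c) refl
    ch₄ : ∀ a b c d → c * b + d * d ≈ (a + d) * d - (a * d - b * c)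
    ch₄ = solve 4 (λ a b c d → c :* b :+ d :* d := (a :+ d) :* d :- (a :* d :- b :* c)) refl

  traceless-square : ∀ m → tr m ≈ 0# → (m · m) ≈M ⟨ - det m ⟩
  traceless-square m t≈0 = M.trans (cayley-hamilton m) (diagonal (a m) , off-diagonal (b m) , off-diagonal (c' m) , diagonal (d m))
    where
    off-diagonal : ∀ x → tr m * x ≈ 0#
    off-diagonal x = trans (*-congʳ t≈0) (zeroˡ x)
    diagonal : ∀ x → tr m * x - det m ≈ - det m
    diagonal x = trans (+-congʳ (off-diagonal x)) (+-identityˡ _)

  traceless-anticommute : ∀ m n → tr m ≈ 0# → tr n ≈ 0# → tr (m · n) ≈ 0# → (n · m) ≈M (-I · (m · n))
  traceless-anticommute m@(mat ma mb mc md) n@(mat na nb nc nd) tm tn tmn = M.trans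
    ( flip (diagonal (polarised₁ ma mb mc md na nb nc nd))
    , flip (off-diagonal (polarised₂ ma mb mc md na nb nc nd))
    , flip (off-diagonal (polarised₃ ma mb mc md na nb nc nd))
    , flip (diagonal (polarised₄ ma mb mc md na nb nc nd)) )
    (M.sym (⟨⟩-·ˡ (- 1#) (m · n)))
    where
    open import Relation.Binary.Reasoning.Setoid setoid
    trm trn trmn : Carrier
    trm = ma + md
    trn = na + nd
    trmn = (ma * na + mb * nc) + (mc * nb + md * nd)
    polarised₁ : ∀ ma mb mc md na nb nc nd → (na * ma + nb * mc) + (ma * na + mb * nc)
                 ≈ (ma + md) * na + (na + nd) * ma + (((ma * na + mb * nc) + (mc * nb + md * nd)) - (ma + md) * (na + nd))
    polarised₁ = solve 8 (λ ma mb mc md na nb nc nd →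
      (na :* ma :+ nb :* mc) :+ (ma :* na :+ mb :* nc)
      := (ma :+ md) :* na :+ (na :+ nd) :* ma :+ (((ma :* na :+ mb :* nc) :+ (mc :* nb :+ md :* nd)) :- (ma :+ md) :* (na :+ nd))) refl
    polarised₄ : ∀ ma mb mc md na nb nc nd → (nc * mb + nd * md) + (mc * nb + md * nd)
                 ≈ (ma + md) * nd + (na + nd) * md + (((ma * na + mb * nc) + (mc * nb + md * nd)) - (ma + md) * (na + nd))
    polarised₄ = solve 8 (λ ma mb mc md na nb nc nd →
      (nc :* mb :+ nd :* md) :+ (mc :* nb :+ md :* nd)
      := (ma :+ md) :* nd :+ (na :+ nd) :* md :+ (((ma :* na :+ mb :* nc) :+ (mc :* nb :+ md :* nd)) :- (ma :+ md) :* (na :+ nd))) refl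
    polarised₂ : ∀ ma mb mc md na nb nc nd → (na * mb + nb * md) + (ma * nb + mb * nd) ≈ (ma + md) * nb + (na + nd) * mb
    polarised₂ = solve 8 (λ ma mb mc md na nb nc nd →
      (na :* mb :+ nb :* md) :+ (ma :* nb :+ mb :* nd) := (ma :+ md) :* nb :+ (na :+ nd) :* mb) refl
    polarised₃ : ∀ ma mb mc md na nb nc nd → (nc * ma + nd * mc) + (mc * na + md * nc) ≈ (ma + md) * nc + (na + nd) * mc
    polarised₃ = solve 8 (λ ma mb mc md na nb nc nd →
      (nc :* ma :+ nd :* mc) :+ (mc :* na :+ md :* nc) := (ma :+ md) :* nc :+ (na :+ nd) :* mc) refl
    off-diagonal : ∀ {u v x y} → u + v ≈ trm * x + trn * y → u + v ≈ 0#
    off-diagonal {u} {v} {x} {y} e = begin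
      u + v               ≈⟨ e ⟩
      trm * x + trn * y   ≈⟨ +-cong (*-congʳ tm) (*-congʳ tn) ⟩
      0# * x + 0# * y     ≈⟨ +-cong (zeroˡ x) (zeroˡ y) ⟩
      0# + 0#             ≈⟨ +-identityˡ 0# ⟩
      0#                  ∎
    diagonal : ∀ {u v x y} → u + v ≈ trm * x + trn * y + (trmn - trm * trn) → u + v ≈ 0#
    diagonal {u} {v} {x} {y} e = begin
      u + v                                    ≈⟨ e ⟩
      trm * x + trn * y + (trmn - trm * trn)   ≈⟨ +-cong (off-diagonal refl) (+-cong tmn (-‿cong (trans (*-congʳ tm) (zeroˡ trn)))) ⟩
      0# + (0# - 0#)                           ≈⟨ +-identityˡ _ ⟩
      0# - 0#                                  ≈⟨ -‿inverseʳ 0# ⟩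
      0#                                       ∎
    flip : ∀ {u v} → u + v ≈ 0# → u ≈ - 1# * v
    flip {u} {v} e = trans (inverseˡ-unique u v e) (sym (-1*x≈-x v))
      where open import Algebra.Properties.Ring ring using (-1*x≈-x)


  four : Carrier
  four = (1# + 1#) * (1# + 1#)

  discriminant : M2 → Carrier
  discriminant m = (a m - d m) * (a m - d m) + four * (b m * c' m)

  discriminant≈tr²-det*4 : ∀ m → discriminant m ≈ tr m * tr m - det m * four
  discriminant≈tr²-det*4 (mat a b c d) = identity a b c d
    where
    identity : ∀ a b c d → (a - d) * (a - d) + (1# + 1#) * (1# + 1#) * (b * c)
                           ≈ (a + d) * (a + d) - (a * d - b * c) * ((1# + 1#) * (1# + 1#))
    identity = solve 4 (λ a b c d → (a :- d) :* (a :- d) :+ (con (+ 1) :+ con (+ 1)) :* (con (+ 1) :+ con (+ 1)) :* (b :* c)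
      := (a :+ d) :* (a :+ d) :- (a :* d :- b :* c) :* ((con (+ 1) :+ con (+ 1)) :* (con (+ 1) :+ con (+ 1)))) refl

  square-scalar⇒tr*b≈0×tr*c≈0×tr*[a-d]≈0 : ∀ {m α} → (m · m) ≈M ⟨ α ⟩ →
                                           tr m * b m ≈ 0# × tr m * c' m ≈ 0# × tr m * (a m - d m) ≈ 0#
  square-scalar⇒tr*b≈0×tr*c≈0×tr*[a-d]≈0 {m@(mat a b c d)} {α} m²≈α@(e₁ , e₂ , e₃ , e₄) =
    trans (sym ch₂) e₂ , trans (sym ch₃) e₃ , (begin
      (a + d) * (a - d)                                   ≈⟨ difference a b c d ⟩
      ((a + d) * a - det m) - ((a + d) * d - det m)        ≈⟨ +-cong (sym ch₁) (-‿cong (sym ch₄)) ⟩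
      (a * a + b * c) - (c * b + d * d)                    ≈⟨ +-cong e₁ (-‿cong e₄) ⟩
      α - α                                                ≈⟨ -‿inverseʳ α ⟩
      0#                                                   ∎)
    where
    open import Relation.Binary.Reasoning.Setoid setoid
    ch₁ : a * a + b * c ≈ (a + d) * a - det m
    ch₁ = proj₁ (cayley-hamilton m)
    ch₂ : a * b + b * d ≈ (a + d) * b
    ch₂ = proj₁ (proj₂ (cayley-hamilton m))
    ch₃ : c * a + d * c ≈ (a + d) * c
    ch₃ = proj₁ (proj₂ (proj₂ (cayley-hamilton m)))
    ch₄ : c * b + d * d ≈ (a + d) * d - det m
    ch₄ = proj₂ (proj₂ (proj₂ (cayley-hamilton m)))
    difference : ∀ a b c d → (a + d) * (a - d) ≈ ((a + d) * a - (a * d - b * c)) - ((a + d) * d - (a * d - b * c))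
    difference = solve 4 (λ a b c d → (a :+ d) :* (a :- d)
      := ((a :+ d) :* a :- (a :* d :- b :* c)) :- ((a :+ d) :* d :- (a :* d :- b :* c))) refl

  square-scalar⇒tr*discriminant≈0 : ∀ {m α} → (m · m) ≈M ⟨ α ⟩ → tr m * discriminant m ≈ 0#
  square-scalar⇒tr*discriminant≈0 {m@(mat a b c d)} m²≈α = begin
    tr m * discriminant m                                    ≈⟨ expand a b c d ⟩
    (tr m * (a - d)) * (a - d) + four * ((tr m * b) * c)     ≈⟨ +-cong (*-congʳ τ[a-d]≈0) (*-congˡ (*-congʳ τb≈0)) ⟩
    0# * (a - d) + four * (0# * c)                           ≈⟨ vanish (a - d) c ⟩
    0#                                                       ∎
    where
    open import Relation.Binary.Reasoning.Setoid setoid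
    τb≈0 : tr m * b ≈ 0#
    τb≈0 = proj₁ (square-scalar⇒tr*b≈0×tr*c≈0×tr*[a-d]≈0 m²≈α)
    τ[a-d]≈0 : tr m * (a - d) ≈ 0#
    τ[a-d]≈0 = proj₂ (proj₂ (square-scalar⇒tr*b≈0×tr*c≈0×tr*[a-d]≈0 m²≈α))
    expand : ∀ a b c d → (a + d) * ((a - d) * (a - d) + (1# + 1#) * (1# + 1#) * (b * c))
                         ≈ ((a + d) * (a - d)) * (a - d) + (1# + 1#) * (1# + 1#) * (((a + d) * b) * c)
    expand = solve 4 (λ a b c d → (a :+ d) :* ((a :- d) :* (a :- d) :+ (con (+ 1) :+ con (+ 1)) :* (con (+ 1) :+ con (+ 1)) :* (b :* c))
      := ((a :+ d) :* (a :- d)) :* (a :- d) :+ (con (+ 1) :+ con (+ 1)) :* (con (+ 1) :+ con (+ 1)) :* (((a :+ d) :* b) :* c)) refl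
    vanish : ∀ x y → 0# * x + (1# + 1#) * (1# + 1#) * (0# * y) ≈ 0#
    vanish = solve 2 (λ x y → con (+ 0) :* x :+ (con (+ 1) :+ con (+ 1)) :* (con (+ 1) :+ con (+ 1)) :* (con (+ 0) :* y) := con (+ 0)) refl

  ⟨⟩-pull : ∀ s m n → (m · (⟨ s ⟩ · n)) ≈M (⟨ s ⟩ · (m · n))
  ⟨⟩-pull s m n = begin
    m · (⟨ s ⟩ · n)   ≈⟨ M.sym (M.assoc m ⟨ s ⟩ n) ⟩
    (m · ⟨ s ⟩) · n   ≈⟨ M.∙-congʳ (M.sym (⟨⟩-central s m)) ⟩
    (⟨ s ⟩ · m) · n   ≈⟨ M.assoc ⟨ s ⟩ m n ⟩
    ⟨ s ⟩ · (m · n)   ∎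
    where open import Relation.Binary.Reasoning.Setoid M.setoid

  ⟨⟩-merge : ∀ s t m → (⟨ s ⟩ · (⟨ t ⟩ · m)) ≈M (⟨ s * t ⟩ · m)
  ⟨⟩-merge s t m = M.trans (M.sym (M.assoc ⟨ s ⟩ ⟨ t ⟩ m)) (M.∙-congʳ (⟨⟩-·-⟨⟩ s t))

  ⟨⟩-factor : ∀ s t m n → ((⟨ s ⟩ · m) · (⟨ t ⟩ · n)) ≈M (⟨ s * t ⟩ · (m · n))
  ⟨⟩-factor s t m n = begin
    (⟨ s ⟩ · m) · (⟨ t ⟩ · n)   ≈⟨ M.assoc ⟨ s ⟩ m (⟨ t ⟩ · n) ⟩
    ⟨ s ⟩ · (m · (⟨ t ⟩ · n))   ≈⟨ M.∙-congˡ (⟨⟩-pull t m n) ⟩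
    ⟨ s ⟩ · (⟨ t ⟩ · (m · n))   ≈⟨ ⟨⟩-merge s t (m · n) ⟩
    ⟨ s * t ⟩ · (m · n)         ∎
    where open import Relation.Binary.Reasoning.Setoid M.setoid

module Determinants {c ℓ} (k : CommutativeRing c ℓ) where
  open CommutativeRing k
  open Matrices k
  open MatrixProperties k
  open import Algebra.Properties.CommutativeSemigroup *-commutativeSemigroup using (xy∙z≈xz∙y)
  open import Relation.Binary.Reasoning.Setoid setoid

  det-I : det I ≈ 1#
  det-I = trans (det-⟨⟩ 1#) (*-identityˡ 1#)

  det-inverse : ∀ {g h} → (g · h) ≈M I → det g * det h ≈ 1#
  det-inverse {g} {h} gh≈I = trans (sym (det-· g h)) (trans (det-cong gh≈I) det-I)

  det-commutator : ∀ {x x' y y'} → (x · x') ≈M I → (y · y') ≈M I → det (((x · y) · x') · y') ≈ 1#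
  det-commutator {x} {x'} {y} {y'} xx'≈I yy'≈I = begin
    det (((x · y) · x') · y')                     ≈⟨ trans (det-· _ y') (*-congʳ (trans (det-· _ x') (*-congʳ (det-· x y)))) ⟩
    ((det x * det y) * det x') * det y'           ≈⟨ *-congʳ (xy∙z≈xz∙y (det x) (det y) (det x')) ⟩
    ((det x * det x') * det y) * det y'           ≈⟨ *-assoc _ _ _ ⟩
    (det x * det x') * (det y * det y')           ≈⟨ *-cong (det-inverse xx'≈I) (det-inverse yy'≈I) ⟩
    1# * 1#                                       ≈⟨ *-identityˡ 1# ⟩
    1#                                            ∎

  det-conjugate : ∀ {g g'} m → (g · g') ≈M I → det ((g · m) · g') ≈ det m
  det-conjugate {g} {g'} m gg'≈I = begin
    det ((g · m) · g')            ≈⟨ trans (det-· _ g') (*-congʳ (det-· g m)) ⟩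
    (det g * det m) * det g'      ≈⟨ xy∙z≈xz∙y (det g) (det m) (det g') ⟩
    (det g * det g') * det m      ≈⟨ *-congʳ (det-inverse gg'≈I) ⟩
    1# * det m                    ≈⟨ *-identityˡ (det m) ⟩
    det m                         ∎

module FieldProperties {c ℓ} (k : CommutativeRing c ℓ) (field' : IsField k) where
  open CommutativeRing k
  open IsField field'
  open import Relation.Binary.Reasoning.Setoid setoid

  x*y≈0⇒y≉0⇒x≈0 : ∀ {x y} → x * y ≈ 0# → ¬ (y ≈ 0#) → x ≈ 0#
  x*y≈0⇒y≉0⇒x≈0 {x} {y} xy≈0 y≉0 with inverse y y≉0
  ... | y⁻¹ , yy⁻¹≈1 = begin
    x              ≈⟨ *-identityʳ x ⟨
    x * 1#         ≈⟨ *-congˡ yy⁻¹≈1 ⟨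
    x * (y * y⁻¹)  ≈⟨ *-assoc x y y⁻¹ ⟨
    (x * y) * y⁻¹  ≈⟨ *-congʳ xy≈0 ⟩
    0# * y⁻¹       ≈⟨ zeroˡ y⁻¹ ⟩
    0#             ∎

  *-≉0 : ∀ {x y} → ¬ (x ≈ 0#) → ¬ (y ≈ 0#) → ¬ (x * y ≈ 0#)
  *-≉0 x≉0 y≉0 xy≈0 = x≉0 (x*y≈0⇒y≉0⇒x≈0 xy≈0 y≉0)

module NonscalarSquareRoots {c ℓ} (k : CommutativeRing c ℓ) (field' : IsField k) (odd : OddChar k) where
  open CommutativeRing k
  open Matrices k
  open MatrixProperties k
  open FieldProperties k field'
  open import Relation.Binary.Reasoning.Setoid setoid
  open import Algebra.Properties.Group +-group using (x∙y⁻¹≈ε⇒x≈y)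

  -- Equality in k is undecidable, so no case split on tr m ≈ 0 is possible. But tr m ≉ 0 would force m
  -- to be scalar, so ¬ ¬ tr m ≈ 0, which already rules out a vanishing discriminant tr² - 4 det.
  square-scalar⇒traceless : ∀ m α → InGL2 m → ¬ IsScalar m → (m · m) ≈M ⟨ α ⟩ → tr m ≈ 0#
  square-scalar⇒traceless m@(mat a b c d) α det≉0 nonscalar m²≈α =
    x*y≈0⇒y≉0⇒x≈0 (square-scalar⇒tr*discriminant≈0 m²≈α) discriminant≉0
    where
    ¬tr≉0 : ¬ ¬ (tr m ≈ 0#)
    ¬tr≉0 tr≉0 = nonscalar (a , refl , cancel τb≈0 , cancel τc≈0 , sym (x∙y⁻¹≈ε⇒x≈y a d (cancel τ[a-d]≈0)))
      where
      cancel : ∀ {x} → tr m * x ≈ 0# → x ≈ 0#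
      cancel {x} e = x*y≈0⇒y≉0⇒x≈0 (trans (*-comm x (tr m)) e) tr≉0
      τb≈0 : tr m * b ≈ 0#
      τb≈0 = proj₁ (square-scalar⇒tr*b≈0×tr*c≈0×tr*[a-d]≈0 m²≈α)
      τc≈0 : tr m * c ≈ 0#
      τc≈0 = proj₁ (proj₂ (square-scalar⇒tr*b≈0×tr*c≈0×tr*[a-d]≈0 m²≈α))
      τ[a-d]≈0 : tr m * (a - d) ≈ 0#
      τ[a-d]≈0 = proj₂ (proj₂ (square-scalar⇒tr*b≈0×tr*c≈0×tr*[a-d]≈0 m²≈α))
    discriminant≉0 : ¬ (discriminant m ≈ 0#)
    discriminant≉0 disc≈0 = ¬tr≉0 λ tr≈0 → det≉0 (x*y≈0⇒y≉0⇒x≈0 (det*four≈0 tr≈0) (*-≉0 odd odd))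
      where
      open import Algebra.Properties.Ring ring using (-‿involutive; -0#≈0#)
      det*four≈0 : tr m ≈ 0# → det m * four ≈ 0#
      det*four≈0 tr≈0 = begin
        det m * four                         ≈⟨ -‿involutive _ ⟨
        - - (det m * four)                   ≈⟨ -‿cong (+-identityˡ _) ⟨
        - (0# - det m * four)                ≈⟨ -‿cong (+-congʳ (trans (*-cong tr≈0 tr≈0) (zeroˡ 0#))) ⟨
        - (tr m * tr m - det m * four)       ≈⟨ -‿cong (discriminant≈tr²-det*4 m) ⟨
        - discriminant m                     ≈⟨ -‿cong disc≈0 ⟩
        - 0#                                 ≈⟨ -0#≈0# ⟩
        0#                                   ∎

module A4 where
  open import Data.Fin as Fin using (Fin; zero; suc; #_)
  open import Data.Fin.Properties using (_≟_; _<?_; all?)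
  open import Data.Nat.Properties using () renaming (_≟_ to _≟ℕ_)
  open import Data.List using (List; []; _∷_; cartesianProduct; length; concatMap; map; allFin)
  open import Data.List.Properties using (filter-≐)
  open import Data.List.Relation.Unary.Any as Any using (Any)
  open import Function.Definitions using (Injective)
  open import Relation.Binary.PropositionalEquality using (refl; sym; trans; cong; subst₂)
  open import Relation.Nullary using (Dec)
  open import Relation.Nullary.Decidable using (map′; _×-dec_; _→-dec_)

  perm : Fin 4 → Fin 4 → Fin 4 → Fin 4 → Perm4
  perm a b c d zero                   = a
  perm a b c d (suc zero)             = b
  perm a b c d (suc (suc zero))       = c
  perm a b c d (suc (suc (suc zero))) = d

  z z⁻¹ p q : Perm4
  z   = perm (# 0) (# 2) (# 3) (# 1)
  z⁻¹ = perm (# 0) (# 3) (# 1) (# 2)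
  p   = perm (# 3) (# 2) (# 1) (# 0)
  q   = perm (# 1) (# 0) (# 3) (# 2)

  id₄ : Perm4
  id₄ i = i

  _^_ : Perm4 → ℕ → Perm4
  σ ^ zero  = id₄
  σ ^ suc n = σ ∘ σ ^ n

  _^ᵇ_ : Perm4 → Bool → Perm4
  σ ^ᵇ b = if b then σ else id₄

  infix 4 _≗?_
  _≗?_ : (σ τ : Perm4) → Dec (σ ≗4 τ)
  σ ≗? τ = all? (λ i → σ i ≟ τ i)

  injective? : (σ : Perm4) → Dec (Injective _≡_ _≡_ σ)
  injective? σ = map′ (λ inj {i} {j} → inj i j) (λ inj i j → inj) (all? λ i → all? λ j → (σ i ≟ σ j) →-dec (i ≟ j))

  inA4? : (σ : Perm4) → Dec (InA4 σ)
  inA4? σ = injective? σ ×-dec (inversions σ ℕ.% 2 ≟ℕ 0)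

  V4⋊C3 : Bool × Bool × ℕ → Perm4
  V4⋊C3 (x , y , e) = (p ^ᵇ x ∘ q ^ᵇ y) ∘ z ^ e

  private
    exponents : List (Bool × Bool × ℕ)
    exponents = cartesianProduct (false ∷ true ∷ []) (cartesianProduct (false ∷ true ∷ []) (0 ∷ 1 ∷ 2 ∷ []))

    tabulated-decomposition : ∀ a b c d → InA4 (perm a b c d) → Any (λ w → perm a b c d ≗4 V4⋊C3 w) exponents
    tabulated-decomposition = from-yes (all? λ a → all? λ b → all? λ c → all? λ d →
      inA4? (perm a b c d) →-dec Any.any? (λ w → perm a b c d ≗? V4⋊C3 w) exponents)

  inversions-cong : ∀ {σ τ} → σ ≗4 τ → inversions σ ≡ inversions τ
  inversions-cong {σ} {τ} σ≗τ = cong length (filter-≐ (inverted? σ) (inverted? τ) (transport σ≗τ , transport (sym ∘ σ≗τ)) pairs)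
    where
    pairs : List (Fin 4 × Fin 4)
    pairs = concatMap (λ i → map (λ j → (i , j)) (allFin 4)) (allFin 4)
    Inverted : Perm4 → Fin 4 × Fin 4 → Set
    Inverted f (i , j) = i Fin.< j × f j Fin.< f i
    inverted? : (f : Perm4) (ij : Fin 4 × Fin 4) → Dec (Inverted f ij)
    inverted? f (i , j) = (i <? j) ×-dec (f j <? f i)
    transport : ∀ {f g : Perm4} → f ≗4 g → ∀ {ij} → Inverted f ij → Inverted g ij
    transport f≗g (i<j , fj<fi) = i<j , subst₂ Fin._<_ (f≗g _) (f≗g _) fj<fi

  InA4-resp : ∀ {σ τ} → σ ≗4 τ → InA4 σ → InA4 τ
  InA4-resp σ≗τ (inj , even) =
    (λ e → inj (trans (σ≗τ _) (trans e (sym (σ≗τ _))))) , trans (cong (ℕ._% 2) (sym (inversions-cong σ≗τ))) even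

  opaque
    A4-decomposition : ∀ σ → InA4 σ → ∃ λ w → σ ≗4 V4⋊C3 w
    A4-decomposition σ σ∈A4 = Any.satisfied (Any.map (λ eq i → trans (tabulated σ i) (eq i))
      (tabulated-decomposition (σ (# 0)) (σ (# 1)) (σ (# 2)) (σ (# 3)) (InA4-resp (tabulated σ) σ∈A4)))
      where
      tabulated : ∀ σ → σ ≗4 perm (σ (# 0)) (σ (# 1)) (σ (# 2)) (σ (# 3))
      tabulated σ zero                   = refl
      tabulated σ (suc zero)             = refl
      tabulated σ (suc (suc zero))       = refl
      tabulated σ (suc (suc (suc zero))) = refl

module Quaternions {c ℓ} (k : CommutativeRing c ℓ) where
  open CommutativeRing k
  open Matrices k
  open MatrixProperties k
  open MonoidProperties M2-monoid
  open import Algebra.Properties.Monoid M2-monoid using (uv∙wx≈u[vw∙x])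
  open import Relation.Binary.Reasoning.Setoid M.setoid

  sign : Bool → Carrier
  sign false = 1#
  sign true  = - 1#

  sign-* : ∀ s t → sign s * sign t ≈ sign (s xor t)
  sign-* false t     = *-identityˡ (sign t)
  sign-* true  false = *-identityʳ (- 1#)
  sign-* true  true  = trans (sym (-‿distribˡ-* 1# (- 1#))) (trans (-‿cong (*-identityˡ (- 1#))) (-‿involutive 1#))
    where open import Algebra.Properties.Ring ring using (-‿distribˡ-*; -‿involutive)

  sign-merge : ∀ s t m → (⟨ sign s ⟩ · (⟨ sign t ⟩ · m)) ≈M (⟨ sign (s xor t) ⟩ · m)
  sign-merge s t m = M.trans (⟨⟩-merge (sign s) (sign t) m) (M.∙-congʳ (⟨⟩-cong (sign-* s t)))

  ^ᵇ-intertwine : ∀ {g m m'} → (g · m) ≈M (m' · g) → ∀ b → (g · m ^ᵇ b) ≈M (m' ^ᵇ b · g)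
  ^ᵇ-intertwine gm false = M.trans (M.identityʳ _) (M.sym (M.identityˡ _))
  ^ᵇ-intertwine gm true  = gm

  ^ᵇ-square : ∀ {m} → (m · m) ≈M -I → ∀ x y → (m ^ᵇ x · m ^ᵇ y) ≈M (⟨ sign (x ∧ y) ⟩ · m ^ᵇ (x xor y))
  ^ᵇ-square m² false y     = M.refl
  ^ᵇ-square m² true  false = M.trans (M.identityʳ _) (M.sym (M.identityˡ _))
  ^ᵇ-square m² true  true  = M.trans m² (M.sym (M.identityʳ -I))


  module Q8 (i j : M2) (i² : (i · i) ≈M -I) (j² : (j · j) ≈M -I) (ji : (j · i) ≈M (-I · (i · j))) where

    ^ᵇ-swap : ∀ y x → (j ^ᵇ y · i ^ᵇ x) ≈M (⟨ sign (y ∧ x) ⟩ · (i ^ᵇ x · j ^ᵇ y))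
    ^ᵇ-swap false x     = M.∙-congˡ (M.sym (M.identityʳ _))
    ^ᵇ-swap true  false = M.trans (M.identityʳ j) (M.sym (M.trans (M.identityˡ (I · j)) (M.identityˡ j)))
    ^ᵇ-swap true  true  = ji

    q8 : Bool → Bool → Bool → M2
    q8 s x y = ⟨ sign s ⟩ · (i ^ᵇ x · j ^ᵇ y)

    InQ8 : M2 → Set ℓ
    InQ8 m = ∃ λ ((s , x , y) : Bool × Bool × Bool) → m ≈M q8 s x y

    q8-· : ∀ s x y s' x' y' → ∃ λ s'' → (q8 s x y · q8 s' x' y') ≈M q8 s'' (x xor x') (y xor y')
    q8-· s x y s' x' y' =
      (s xor s') xor ((y ∧ x') xor ((x ∧ x') xor (y ∧ y'))) , (begin
      q8 s x y · q8 s' x' y'                                      ≈⟨ ⟨⟩-factor (sign s) (sign s') _ _ ⟩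
      ⟨ sign s * sign s' ⟩ · ((iˣ · jʸ) · (iˣ' · jʸ'))            ≈⟨ M.∙-cong (⟨⟩-cong (sign-* s s')) reorder ⟩
      ⟨ sign (s xor s') ⟩ · (⟨ sign (y ∧ x') ⟩ · (⟨ sign ((x ∧ x') xor (y ∧ y')) ⟩ · (i ^ᵇ (x xor x') · j ^ᵇ (y xor y'))))
                                                                  ≈⟨ M.∙-congˡ (sign-merge (y ∧ x') ((x ∧ x') xor (y ∧ y')) _) ⟩
      ⟨ sign (s xor s') ⟩ · (⟨ sign ((y ∧ x') xor ((x ∧ x') xor (y ∧ y'))) ⟩ · (i ^ᵇ (x xor x') · j ^ᵇ (y xor y')))
                                                                  ≈⟨ sign-merge (s xor s') ((y ∧ x') xor ((x ∧ x') xor (y ∧ y'))) _ ⟩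
      q8 ((s xor s') xor ((y ∧ x') xor ((x ∧ x') xor (y ∧ y')))) (x xor x') (y xor y') ∎)
      where
      iˣ jʸ iˣ' jʸ' : M2
      iˣ = i ^ᵇ x
      jʸ = j ^ᵇ y
      iˣ' = i ^ᵇ x'
      jʸ' = j ^ᵇ y'
      reorder : ((iˣ · jʸ) · (iˣ' · jʸ')) ≈M (⟨ sign (y ∧ x') ⟩ · (⟨ sign ((x ∧ x') xor (y ∧ y')) ⟩ · (i ^ᵇ (x xor x') · j ^ᵇ (y xor y'))))
      reorder = begin
        (iˣ · jʸ) · (iˣ' · jʸ')                                 ≈⟨ uv∙wx≈u[vw∙x] iˣ jʸ iˣ' jʸ' ⟩
        iˣ · ((jʸ · iˣ') · jʸ')                                 ≈⟨ M.∙-congˡ (M.∙-congʳ (^ᵇ-swap y x')) ⟩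
        iˣ · ((⟨ sign (y ∧ x') ⟩ · (iˣ' · jʸ)) · jʸ')           ≈⟨ M.∙-congˡ (M.assoc _ _ _) ⟩
        iˣ · (⟨ sign (y ∧ x') ⟩ · ((iˣ' · jʸ) · jʸ'))           ≈⟨ ⟨⟩-pull (sign (y ∧ x')) _ _ ⟩
        ⟨ sign (y ∧ x') ⟩ · (iˣ · ((iˣ' · jʸ) · jʸ'))           ≈⟨ M.∙-congˡ (M.∙-congˡ (M.assoc _ _ _)) ⟩
        ⟨ sign (y ∧ x') ⟩ · (iˣ · (iˣ' · (jʸ · jʸ')))           ≈⟨ M.∙-congˡ (M.sym (M.assoc _ _ _)) ⟩
        ⟨ sign (y ∧ x') ⟩ · ((iˣ · iˣ') · (jʸ · jʸ'))           ≈⟨ M.∙-congˡ (M.∙-cong (^ᵇ-square i² x x') (^ᵇ-square j² y y')) ⟩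
        ⟨ sign (y ∧ x') ⟩ · ((⟨ sign (x ∧ x') ⟩ · i ^ᵇ (x xor x')) · (⟨ sign (y ∧ y') ⟩ · j ^ᵇ (y xor y')))
                                                                ≈⟨ M.∙-congˡ (⟨⟩-factor (sign (x ∧ x')) (sign (y ∧ y')) _ _) ⟩
        ⟨ sign (y ∧ x') ⟩ · (⟨ sign (x ∧ x') * sign (y ∧ y') ⟩ · (i ^ᵇ (x xor x') · j ^ᵇ (y xor y')))
                                                                ≈⟨ M.∙-congˡ (M.∙-congʳ (⟨⟩-cong (sign-* (x ∧ x') (y ∧ y')))) ⟩
        ⟨ sign (y ∧ x') ⟩ · (⟨ sign ((x ∧ x') xor (y ∧ y')) ⟩ · (i ^ᵇ (x xor x') · j ^ᵇ (y xor y'))) ∎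

    InQ8-· : ∀ {m n} → InQ8 m → InQ8 n → InQ8 (m · n)
    InQ8-· ((s , x , y) , m≈) ((s' , x' , y') , n≈) =
      (proj₁ product , x xor x' , y xor y') , M.trans (M.∙-cong m≈ n≈) (proj₂ product)
      where
      product : ∃ λ s'' → (q8 s x y · q8 s' x' y') ≈M q8 s'' (x xor x') (y xor y')
      product = q8-· s x y s' x' y'

    InQ8-I : InQ8 I
    InQ8-I = (false , false , false) , M.sym (M.trans (M.identityˡ (I · I)) (M.identityˡ I))

    InQ8-sign : ∀ t {m} → InQ8 m → InQ8 (⟨ sign t ⟩ · m)
    InQ8-sign t ((s , x , y) , m≈) = (t xor s , x , y) , M.trans (M.∙-congˡ m≈) (sign-merge t s _)

    InQ8-resp : ∀ {m n} → m ≈M n → InQ8 m → InQ8 n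
    InQ8-resp m≈n (u , m≈) = u , M.trans (M.sym m≈n) m≈

    q8-square : ∀ s x y → ∃ λ t → (q8 s x y · q8 s x y) ≈M ⟨ sign t ⟩
    q8-square s x y = proj₁ product , M.trans (≡.subst₂ (λ u v → (q8 s x y · q8 s x y) ≈M q8 (proj₁ product) u v)
                                                 (xor-same x) (xor-same y) (proj₂ product))
                                               (M.trans (M.∙-congˡ (M.identityˡ I)) (M.identityʳ _))
      where
      product : ∃ λ t → (q8 s x y · q8 s x y) ≈M q8 t (x xor x) (y xor y)
      product = q8-· s x y s x y

    InQ8-invertible : ∀ {m} → InQ8 m → ∃ λ m' → InQ8 m' × (m' · m) ≈M I × (m · m') ≈M I
    InQ8-invertible {m} ((s , x , y) , m≈) = ⟨ sign t ⟩ · q8 s x y , InQ8-sign t ((s , x , y) , M.refl) , left , right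
      where
      t : Bool
      t = proj₁ (q8-square s x y)
      square : (q8 s x y · q8 s x y) ≈M ⟨ sign t ⟩
      square = proj₂ (q8-square s x y)
      cancel : (⟨ sign t ⟩ · (q8 s x y · q8 s x y)) ≈M I
      cancel = begin
        ⟨ sign t ⟩ · (q8 s x y · q8 s x y)   ≈⟨ M.∙-congˡ square ⟩
        ⟨ sign t ⟩ · ⟨ sign t ⟩              ≈⟨ ⟨⟩-·-⟨⟩ (sign t) (sign t) ⟩
        ⟨ sign t * sign t ⟩                  ≈⟨ ⟨⟩-cong (sign-* t t) ⟩
        ⟨ sign (t xor t) ⟩                   ≡⟨ ≡.cong (⟨_⟩ ∘ sign) (xor-same t) ⟩
        I                                    ∎
      left : ((⟨ sign t ⟩ · q8 s x y) · m) ≈M I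
      left = M.trans (M.trans (M.∙-congˡ m≈) (M.assoc _ _ _)) cancel
      right : (m · (⟨ sign t ⟩ · q8 s x y)) ≈M I
      right = M.trans (M.trans (⟨⟩-pull (sign t) m _) (M.∙-congˡ (M.∙-congʳ m≈))) cancel

    InQ8-inverse : ∀ {m n} → InQ8 m → (m · n) ≈M I → InQ8 n
    InQ8-inverse m∈Q8 mn≈I =
      let (m' , m'∈Q8 , m'm≈I , _) = InQ8-invertible m∈Q8 in InQ8-resp (M.sym (inverse-unique m'm≈I mn≈I)) m'∈Q8

    Q8-normalised-by : ∀ {g} → (g · i) ≈M (j · g) → (g · j) ≈M ((i · j) · g) → NormalisedBy InQ8 g
    Q8-normalised-by {g} gi gj {m} ((s , x , y) , m≈) =
      ⟨ sign s ⟩ · (j ^ᵇ x · (i · j) ^ᵇ y) , InQ8-sign s (InQ8-· (jˣ∈Q8 x) (ijʸ∈Q8 y)) , (begin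
        g · m                                          ≈⟨ M.∙-congˡ m≈ ⟩
        g · (⟨ sign s ⟩ · (i ^ᵇ x · j ^ᵇ y))           ≈⟨ ⟨⟩-pull (sign s) g _ ⟩
        ⟨ sign s ⟩ · (g · (i ^ᵇ x · j ^ᵇ y))           ≈⟨ M.∙-congˡ (intertwine-∙ (^ᵇ-intertwine gi x) (^ᵇ-intertwine gj y)) ⟩
        ⟨ sign s ⟩ · ((j ^ᵇ x · (i · j) ^ᵇ y) · g)     ≈⟨ M.sym (M.assoc _ _ _) ⟩
        (⟨ sign s ⟩ · (j ^ᵇ x · (i · j) ^ᵇ y)) · g     ∎)
      where
      jˣ∈Q8 : ∀ x → InQ8 (j ^ᵇ x)
      jˣ∈Q8 x = (false , false , x) , M.sym (M.trans (M.identityˡ _) (M.identityˡ _))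
      ijʸ∈Q8 : ∀ y → InQ8 ((i · j) ^ᵇ y)
      ijʸ∈Q8 false = InQ8-I
      ijʸ∈Q8 true  = (false , true , true) , M.sym (M.identityˡ _)

    module _ (tr-i : tr i ≈ 0#) (tr-j : tr j ≈ 0#) (tr-ij : tr (i · j) ≈ 0#) where

      private
        scaled-trace : ∀ {m} s x y → m ≈M q8 s x y → tr m ≈ sign s * tr (i ^ᵇ x · j ^ᵇ y)
        scaled-trace s x y m≈ = trans (tr-cong m≈) (tr-⟨⟩· (sign s) (i ^ᵇ x · j ^ᵇ y))

        traceless : ∀ {m} s x y → m ≈M q8 s x y → tr (i ^ᵇ x · j ^ᵇ y) ≈ 0# → tr m ≈ 0#
        traceless s x y m≈ t≈0 = trans (scaled-trace s x y m≈) (trans (*-congˡ t≈0) (zeroʳ (sign s)))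

      InQ8-trace : ∀ {m} → InQ8 m → In0±2 (tr m)
      InQ8-trace ((false , false , false) , m≈) =
        inj₂ (inj₁ (trans (scaled-trace false false false m≈) (trans (*-identityˡ _) (tr-cong (M.identityˡ I)))))
      InQ8-trace ((true  , false , false) , m≈) =
        inj₂ (inj₂ (trans (scaled-trace true false false m≈) (trans (-1*x≈-x _) (-‿cong (tr-cong (M.identityˡ I))))))
        where open import Algebra.Properties.Ring ring using (-1*x≈-x)
      InQ8-trace ((s , true  , false) , m≈) = inj₁ (traceless s true false m≈ (trans (tr-cong (M.identityʳ i)) tr-i))
      InQ8-trace ((s , false , true)  , m≈) = inj₁ (traceless s false true m≈ (trans (tr-cong (M.identityˡ j)) tr-j))
      InQ8-trace ((s , true  , true)  , m≈) = inj₁ (traceless s true true m≈ tr-ij)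

module Lifts {c ℓ ℓᴳ} (k : CommutativeRing c ℓ) {G : Matrices.M2 k → Set ℓᴳ}
             (G-subgroup : Matrices.IsSubgroupGL2 k G) (G/scalars≅A4 : ImageInPGL2IsA4 k G) where
  open CommutativeRing k
  open Matrices k
  open MatrixProperties k
  open MonoidProperties M2-monoid
  open IsSubgroupGL2 G-subgroup renaming (resp to ∈G-resp; one to I∈G; mul to ·∈G; inv to inverse∈G)
  open ImageInPGL2IsA4 G/scalars≅A4
  open A4 renaming (_^_ to _^ᴾ_; _^ᵇ_ to _^ᵇᴾ_)

  infix 4 _↦_
  _↦_ : M2 → Perm4 → Set ℓᴳ
  g ↦ σ = Σ (G g) λ g∈G → φ g g∈G ≗4 σ

  ↦-≗ : ∀ {g σ τ} → σ ≗4 τ → g ↦ σ → g ↦ τ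
  ↦-≗ σ≗τ (g∈G , φg) = g∈G , λ i → ≡.trans (φg i) (σ≗τ i)

  ↦-resp : ∀ {g h σ} → g ≈M h → g ↦ σ → h ↦ σ
  ↦-resp g≈h (g∈G , φg) = ∈G-resp g≈h g∈G , λ i → ≡.trans (≡.sym (φ-resp g∈G (∈G-resp g≈h g∈G) g≈h i)) (φg i)

  ↦-I : I ↦ id₄
  ↦-I = I∈G , φ-scalar I I∈G (1# , M.refl)

  ↦-· : ∀ {g h σ τ} → g ↦ σ → h ↦ τ → (g · h) ↦ (σ ∘ τ)
  ↦-· {σ = σ} (g∈G , φg) (h∈G , φh) = ·∈G g∈G h∈G , λ i →
    ≡.trans (φ-hom g∈G h∈G (·∈G g∈G h∈G) i) (≡.trans (φg _) (≡.cong σ (φh i)))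

  ↦-φ : ∀ {g} (g∈G : G g) → g ↦ φ g g∈G
  ↦-φ g∈G = g∈G , λ _ → ≡.refl

  ↦-unique : ∀ {g σ τ} → g ↦ σ → g ↦ τ → σ ≗4 τ
  ↦-unique (g∈G , φg) (g∈G' , φg') i = ≡.trans (≡.sym (φg i)) (≡.trans (φ-resp g∈G g∈G' M.refl i) (φg' i))

  ↦-right-inverse : ∀ {g h σ σ'} → g ↦ σ → G h → (g · h) ≈M I → (∀ i → σ' (σ i) ≡ i) → h ↦ σ'
  ↦-right-inverse {σ = σ} {σ'} g↦σ h∈G gh≈I σ'σ≗id = h∈G , λ i →
    ≡.trans (≡.sym (σ'σ≗id _)) (≡.cong σ' (↦-unique (↦-resp gh≈I (↦-· g↦σ (↦-φ h∈G))) ↦-I i))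

  ↦-inA4 : ∀ {g σ} → g ↦ σ → InA4 σ
  ↦-inA4 {g} (g∈G , φg) = InA4-resp φg (φ-A4 g g∈G)

  ↦-surjective : ∀ {σ} → InA4 σ → ∃ λ g → g ↦ σ
  ↦-surjective σ∈A4 = φ-surj _ σ∈A4

  ↦-kernel : ∀ {g} → g ↦ id₄ → IsScalar g
  ↦-kernel {g} (g∈G , φg) = φ-kernel g g∈G φg

  ↦-nonscalar : ∀ {g σ} → g ↦ σ → ¬ (σ ≗4 id₄) → ¬ IsScalar g
  ↦-nonscalar {g} (g∈G , φg) σ≉id g-scalar = σ≉id λ i → ≡.trans (≡.sym (φg i)) (φ-scalar g g∈G g-scalar i)

  inverse-two-sided : ∀ {g h} → G h → (g · h) ≈M I → (h · g) ≈M I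
  inverse-two-sided h∈G gh≈I =
    let (h' , _ , hh'≈I) = inverse∈G h∈G in M.trans (M.∙-congˡ (M.sym (inverse-unique gh≈I hh'≈I))) hh'≈I

  same-image⇒scalar-multiple : ∀ {g h σ} → g ↦ σ → h ↦ σ → ∃ λ s → g ≈M (⟨ s ⟩ · h)
  same-image⇒scalar-multiple {g} {h} g↦σ h↦σ =
    let (h' , h'∈G , hh'≈I) = inverse∈G (proj₁ h↦σ)
        σh'≗id = ↦-unique (↦-resp hh'≈I (↦-· h↦σ (↦-φ h'∈G))) ↦-I
        (s , gh'≈s) = ↦-kernel (↦-≗ σh'≗id (↦-· g↦σ (↦-φ h'∈G)))
    in s , (begin
      g               ≈⟨ M.sym (M.identityʳ g) ⟩
      g · I           ≈⟨ M.∙-congˡ (M.sym (inverse-two-sided h'∈G hh'≈I)) ⟩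
      g · (h' · h)    ≈⟨ M.sym (M.assoc g h' h) ⟩
      (g · h') · h    ≈⟨ M.∙-congʳ gh'≈s ⟩
      ⟨ s ⟩ · h       ∎)
    where open import Relation.Binary.Reasoning.Setoid M.setoid

  ^ᵇ-↦ : ∀ {g σ} → g ↦ σ → ∀ b → g ^ᵇ b ↦ σ ^ᵇᴾ b
  ^ᵇ-↦ g↦σ false = ↦-I
  ^ᵇ-↦ g↦σ true  = g↦σ

  ^-↦ : ∀ {g σ} → g ↦ σ → ∀ e → g ^ e ↦ σ ^ᴾ e
  ^-↦ g↦σ zero    = ↦-I
  ^-↦ g↦σ (suc e) = ↦-· g↦σ (^-↦ g↦σ e)

module CommutatorSubgroup {c ℓ ℓᴳ} (k : CommutativeRing c ℓ) (field' : IsField k) (odd : OddChar k)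
    {G : Matrices.M2 k → Set ℓᴳ} (G-subgroup : Matrices.IsSubgroupGL2 k G) (G/scalars≅A4 : ImageInPGL2IsA4 k G) where
  open CommutativeRing k
  open Matrices k
  open MatrixProperties k
  open MonoidProperties M2-monoid
  open Determinants k
  open NonscalarSquareRoots k field' odd
  open Lifts k G-subgroup G/scalars≅A4
  open A4 renaming (_^_ to _^ᴾ_; _^ᵇ_ to _^ᵇᴾ_)
  open IsSubgroupGL2 G-subgroup using (inGL)
  open import Relation.Binary.Reasoning.Setoid M.setoid

  ↦-involution⇒traceless : ∀ {g σ} → g ↦ σ → (σ ∘ σ) ≗4 id₄ → ¬ (σ ≗4 id₄) → tr g ≈ 0#
  ↦-involution⇒traceless {g} g↦σ σσ≗id σ≉id =
    let (α , g²≈α) = ↦-kernel (↦-≗ σσ≗id (↦-· g↦σ g↦σ))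
    in square-scalar⇒traceless g α (inGL (proj₁ g↦σ)) (↦-nonscalar g↦σ σ≉id) g²≈α

  unimodular-traceless-square : ∀ {m} → det m ≈ 1# → tr m ≈ 0# → (m · m) ≈M -I
  unimodular-traceless-square {m} det≈1 tr≈0 = M.trans (traceless-square m tr≈0) (⟨⟩-cong (-‿cong det≈1))

  scaled-inverse : ∀ {g g' s s⁻¹ U U' P P'} → s⁻¹ * s ≈ 1# → (U' · U) ≈M I → (P' · P) ≈M I →
                   g ≈M (⟨ s ⟩ · (U · P)) → (g · g') ≈M I → g' ≈M (⟨ s⁻¹ ⟩ · (P' · U'))
  scaled-inverse {g} {g'} {s} {s⁻¹} {U} {U'} {P} {P'} s⁻¹s≈1 U'U≈I P'P≈I g≈ gg'≈I = inverse-unique left-inverse gg'≈I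
    where
    left-inverse : ((⟨ s⁻¹ ⟩ · (P' · U')) · g) ≈M I
    left-inverse = begin
      (⟨ s⁻¹ ⟩ · (P' · U')) · g                 ≈⟨ M.∙-congˡ g≈ ⟩
      (⟨ s⁻¹ ⟩ · (P' · U')) · (⟨ s ⟩ · (U · P)) ≈⟨ ⟨⟩-factor s⁻¹ s (P' · U') (U · P) ⟩
      ⟨ s⁻¹ * s ⟩ · ((P' · U') · (U · P))       ≈⟨ M.∙-cong (⟨⟩-cong s⁻¹s≈1) (cancelᶜ U'U≈I P' P) ⟩
      I · (P' · P)                              ≈⟨ M.identityˡ (P' · P) ⟩
      P' · P                                    ≈⟨ P'P≈I ⟩
      I                                         ∎
      where open import Algebra.Properties.Monoid M2-monoid using (cancelᶜ)

  scaled-commutator : ∀ {x x' y y' s s' t t' A A' B B'} →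
                      x ≈M (⟨ s ⟩ · A) → y ≈M (⟨ t ⟩ · B) → x' ≈M (⟨ s' ⟩ · A') → y' ≈M (⟨ t' ⟩ · B') →
                      s' * s ≈ 1# → t' * t ≈ 1# → (((x · y) · x') · y') ≈M (((A · B) · A') · B')
  scaled-commutator {x} {x'} {y} {y'} {s} {s'} {t} {t'} {A} {A'} {B} {B'} x≈ y≈ x'≈ y'≈ s's≈1 t't≈1 = begin
    ((x · y) · x') · y'
      ≈⟨ M.∙-cong (M.∙-cong (M.∙-cong x≈ y≈) x'≈) y'≈ ⟩
    (((⟨ s ⟩ · A) · (⟨ t ⟩ · B)) · (⟨ s' ⟩ · A')) · (⟨ t' ⟩ · B')
      ≈⟨ M.∙-congʳ (M.∙-congʳ (⟨⟩-factor s t A B)) ⟩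
    ((⟨ s * t ⟩ · (A · B)) · (⟨ s' ⟩ · A')) · (⟨ t' ⟩ · B')
      ≈⟨ M.∙-congʳ (⟨⟩-factor (s * t) s' (A · B) A') ⟩
    (⟨ (s * t) * s' ⟩ · ((A · B) · A')) · (⟨ t' ⟩ · B')
      ≈⟨ ⟨⟩-factor ((s * t) * s') t' ((A · B) · A') B' ⟩
    ⟨ ((s * t) * s') * t' ⟩ · (((A · B) · A') · B')
      ≈⟨ M.∙-congʳ (⟨⟩-cong scalar≈1) ⟩
    I · (((A · B) · A') · B')
      ≈⟨ M.identityˡ _ ⟩
    ((A · B) · A') · B'
      ∎
    where
    open import Algebra.Properties.CommutativeSemigroup *-commutativeSemigroup using (xy∙z≈xz∙y)
    scalar≈1 : ((s * t) * s') * t' ≈ 1#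
    scalar≈1 = trans (*-congʳ (xy∙z≈xz∙y s t s')) (trans (*-assoc (s * s') t t')
                 (trans (*-cong (trans (*-comm s s') s's≈1) (trans (*-comm t t') t't≈1)) (*-identityˡ 1#)))

  invertible-scalar-factor : ∀ {g s N} → InGL2 g → g ≈M (⟨ s ⟩ · N) → ∃ λ s⁻¹ → s⁻¹ * s ≈ 1#
  invertible-scalar-factor {g} {s} {N} g∈GL g≈sN =
    let (s⁻¹ , ss⁻¹≈1) = inverse s s≉0 in s⁻¹ , trans (*-comm s⁻¹ s) ss⁻¹≈1
    where
    open IsField field' using (inverse)
    s≉0 : ¬ (s ≈ 0#)
    s≉0 s≈0 = g∈GL (trans (det-cong g≈sN) (trans (det-· ⟨ s ⟩ N)
                (trans (*-congʳ (trans (det-⟨⟩ s) (trans (*-congʳ s≈0) (zeroˡ s)))) (zeroˡ (det N)))))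

  module _ {Z Z' T T'} (Z↦z : Z ↦ z) (Z'∈G : G Z') (ZZ'≈I : (Z · Z') ≈M I)
                       (T↦q : T ↦ q) (T'∈G : G T') (TT'≈I : (T · T') ≈M I) where

    Z'Z≈I : (Z' · Z) ≈M I
    Z'Z≈I = inverse-two-sided Z'∈G ZZ'≈I

    Z'↦z⁻¹ : Z' ↦ z⁻¹
    Z'↦z⁻¹ = ↦-right-inverse Z↦z Z'∈G ZZ'≈I (from-yes (z⁻¹ ∘ z ≗? id₄))

    T'↦q : T' ↦ q
    T'↦q = ↦-right-inverse T↦q T'∈G TT'≈I (from-yes (q ∘ q ≗? id₄))

    X : M2
    X = ((Z · T) · Z') · T'

    X∈[G,G] : Comm G X
    X∈[G,G] = gen (proj₁ Z↦z) Z'∈G (proj₁ T↦q) T'∈G ZZ'≈I TT'≈I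

    X↦p : X ↦ p
    X↦p = ↦-≗ (from-yes (((z ∘ q) ∘ z⁻¹) ∘ q ≗? p)) (↦-· (↦-· (↦-· Z↦z T↦q) Z'↦z⁻¹) T'↦q)

    det-X : det X ≈ 1#
    det-X = det-commutator ZZ'≈I TT'≈I

    tr-X : tr X ≈ 0#
    tr-X = ↦-involution⇒traceless X↦p (from-yes (p ∘ p ≗? id₄)) (from-no (p ≗? id₄))

    X²≈-I : (X · X) ≈M -I
    X²≈-I = unimodular-traceless-square det-X tr-X

    conjugate-by-Z : ∀ m → (Z · m) ≈M (((Z · m) · Z') · Z)
    conjugate-by-Z m = M.sym (M.trans (M.assoc (Z · m) Z' Z) (M.trans (M.∙-congˡ Z'Z≈I) (M.identityʳ (Z · m))))

    Y : M2
    Y = (Z · X) · Z'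

    Y↦q : Y ↦ q
    Y↦q = ↦-≗ (from-yes ((z ∘ p) ∘ z⁻¹ ≗? q)) (↦-· (↦-· Z↦z X↦p) Z'↦z⁻¹)

    det-Y : det Y ≈ 1#
    det-Y = trans (det-conjugate X ZZ'≈I) det-X

    tr-Y : tr Y ≈ 0#
    tr-Y = ↦-involution⇒traceless Y↦q (from-yes (q ∘ q ≗? id₄)) (from-no (q ≗? id₄))

    Y²≈-I : (Y · Y) ≈M -I
    Y²≈-I = unimodular-traceless-square det-Y tr-Y

    tr-XY : tr (X · Y) ≈ 0#
    tr-XY = ↦-involution⇒traceless (↦-· X↦p Y↦q) (from-yes ((p ∘ q) ∘ (p ∘ q) ≗? id₄)) (from-no (p ∘ q ≗? id₄))

    YX≈-XY : (Y · X) ≈M (-I · (X · Y))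
    YX≈-XY = traceless-anticommute X Y tr-X tr-Y tr-XY

    W : M2
    W = (Z · Y) · Z'

    W↦pq : W ↦ p ∘ q
    W↦pq = ↦-≗ (from-yes ((z ∘ q) ∘ z⁻¹ ≗? p ∘ q)) (↦-· (↦-· Z↦z Y↦q) Z'↦z⁻¹)

    W[YX]↦id : (W · (Y · X)) ↦ id₄
    W[YX]↦id = ↦-≗ (from-yes ((p ∘ q) ∘ (q ∘ p) ≗? id₄)) (↦-· W↦pq (↦-· Y↦q X↦p))

    μ-scalar : IsScalar (W · (Y · X))
    μ-scalar = ↦-kernel W[YX]↦id

    μ : Carrier
    μ = proj₁ μ-scalar

    W[YX]≈μ : (W · (Y · X)) ≈M ⟨ μ ⟩
    W[YX]≈μ = proj₂ μ-scalar

    [YX][XY]≈I : ((Y · X) · (X · Y)) ≈M I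
    [YX][XY]≈I = begin
      (Y · X) · (X · Y)     ≈⟨ M.assoc Y X (X · Y) ⟩
      Y · (X · (X · Y))     ≈⟨ M.∙-congˡ (M.sym (M.assoc X X Y)) ⟩
      Y · ((X · X) · Y)     ≈⟨ M.∙-congˡ (M.∙-congʳ X²≈-I) ⟩
      Y · (-I · Y)          ≈⟨ ⟨⟩-pull (- 1#) Y Y ⟩
      -I · (Y · Y)          ≈⟨ M.∙-congˡ Y²≈-I ⟩
      -I · -I               ≈⟨ ⟨⟩-·-⟨⟩ (- 1#) (- 1#) ⟩
      ⟨ - 1# * - 1# ⟩       ≈⟨ ⟨⟩-cong (-1*-1≈1) ⟩
      I                     ∎
      where
      -1*-1≈1 : - 1# * - 1# ≈ 1#
      -1*-1≈1 = trans (-1*x≈-x (- 1#)) (-‿involutive 1#)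
        where open import Algebra.Properties.Ring ring using (-1*x≈-x; -‿involutive)

    W≈μXY : W ≈M (⟨ μ ⟩ · (X · Y))
    W≈μXY = begin
      W                                 ≈⟨ M.sym (M.identityʳ W) ⟩
      W · I                             ≈⟨ M.∙-congˡ (M.sym [YX][XY]≈I) ⟩
      W · ((Y · X) · (X · Y))           ≈⟨ M.sym (M.assoc W (Y · X) (X · Y)) ⟩
      (W · (Y · X)) · (X · Y)           ≈⟨ M.∙-congʳ W[YX]≈μ ⟩
      ⟨ μ ⟩ · (X · Y)                   ∎

    μ²≈1 : μ * μ ≈ 1#
    μ²≈1 = trans (sym (det-⟨⟩ μ)) (trans (sym (*-identityʳ (det ⟨ μ ⟩))) (trans (*-congˡ (sym det-XY))
             (trans (sym (det-· ⟨ μ ⟩ (X · Y))) (trans (sym (det-cong W≈μXY)) (trans (det-conjugate Y ZZ'≈I) det-Y)))))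
      where
      det-XY : det (X · Y) ≈ 1#
      det-XY = trans (det-· X Y) (trans (*-cong det-X det-Y) (*-identityˡ 1#))

    μ²-I : ⟨ μ * μ ⟩ ≈M I
    μ²-I = ⟨⟩-cong μ²≈1

    -- The sign of μ cannot be decided; rescaling X and Y by μ makes conjugation by Z sign-free.
    i j : M2
    i = ⟨ μ ⟩ · X
    j = ⟨ μ ⟩ · Y

    i↦p : i ↦ p
    i↦p = ↦-resp (M.∙-congʳ W[YX]≈μ) (↦-· W[YX]↦id X↦p)

    j↦q : j ↦ q
    j↦q = ↦-resp (M.∙-congʳ W[YX]≈μ) (↦-· W[YX]↦id Y↦q)

    rescaled : ∀ m n → ((⟨ μ ⟩ · m) · (⟨ μ ⟩ · n)) ≈M (m · n)
    rescaled m n = M.trans (⟨⟩-factor μ μ m n) (M.trans (M.∙-congʳ μ²-I) (M.identityˡ (m · n)))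

    i²≈-I : (i · i) ≈M -I
    i²≈-I = M.trans (rescaled X X) X²≈-I

    j²≈-I : (j · j) ≈M -I
    j²≈-I = M.trans (rescaled Y Y) Y²≈-I

    ji≈-ij : (j · i) ≈M (-I · (i · j))
    ji≈-ij = M.trans (rescaled Y X) (M.trans YX≈-XY (M.∙-congˡ (M.sym (rescaled X Y))))

    Zi≈jZ : (Z · i) ≈M (j · Z)
    Zi≈jZ = begin
      Z · (⟨ μ ⟩ · X)         ≈⟨ ⟨⟩-pull μ Z X ⟩
      ⟨ μ ⟩ · (Z · X)         ≈⟨ M.∙-congˡ (conjugate-by-Z X) ⟩
      ⟨ μ ⟩ · (Y · Z)         ≈⟨ M.sym (M.assoc ⟨ μ ⟩ Y Z) ⟩
      (⟨ μ ⟩ · Y) · Z         ∎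

    Zj≈ijZ : (Z · j) ≈M ((i · j) · Z)
    Zj≈ijZ = begin
      Z · (⟨ μ ⟩ · Y)                   ≈⟨ ⟨⟩-pull μ Z Y ⟩
      ⟨ μ ⟩ · (Z · Y)                   ≈⟨ M.∙-congˡ (conjugate-by-Z Y) ⟩
      ⟨ μ ⟩ · (W · Z)                   ≈⟨ M.∙-congˡ (M.∙-congʳ W≈μXY) ⟩
      ⟨ μ ⟩ · ((⟨ μ ⟩ · (X · Y)) · Z)   ≈⟨ M.∙-congˡ (M.assoc ⟨ μ ⟩ (X · Y) Z) ⟩
      ⟨ μ ⟩ · (⟨ μ ⟩ · ((X · Y) · Z))   ≈⟨ ⟨⟩-merge μ μ ((X · Y) · Z) ⟩
      ⟨ μ * μ ⟩ · ((X · Y) · Z)         ≈⟨ M.sym (M.assoc ⟨ μ * μ ⟩ (X · Y) Z) ⟩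
      (⟨ μ * μ ⟩ · (X · Y)) · Z         ≈⟨ M.∙-congʳ (M.sym (⟨⟩-factor μ μ X Y)) ⟩
      (i · j) · Z                       ∎

    tr-i : tr i ≈ 0#
    tr-i = trans (tr-⟨⟩· μ X) (trans (*-congˡ tr-X) (zeroʳ μ))

    tr-j : tr j ≈ 0#
    tr-j = trans (tr-⟨⟩· μ Y) (trans (*-congˡ tr-Y) (zeroʳ μ))

    tr-ij : tr (i · j) ≈ 0#
    tr-ij = trans (tr-cong (rescaled X Y)) tr-XY

    open Quaternions.Q8 k i j i²≈-I j²≈-I ji≈-ij

    normal-form : ∀ {g} → G g → ∃ λ s → ∃ λ U → ∃ λ e → InQ8 U × g ≈M (⟨ s ⟩ · (U · Z ^ e))
    normal-form g∈G =
      let ((x , y , e) , φg≗) = A4-decomposition _ (↦-inA4 (↦-φ g∈G))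
          N↦ = ↦-· (↦-· (^ᵇ-↦ i↦p x) (^ᵇ-↦ j↦q y)) (^-↦ Z↦z e)
          (s , g≈sN) = same-image⇒scalar-multiple (↦-≗ φg≗ (↦-φ g∈G)) N↦
      in s , i ^ᵇ x · j ^ᵇ y , e , ((false , x , y) , M.sym (M.identityˡ _)) , g≈sN

    Zⁿ-normalises-Q8 : ∀ n → NormalisedBy InQ8 (Z ^ n)
    Zⁿ-normalises-Q8 = ^-normalises (Q8-normalised-by Zi≈jZ Zj≈ijZ)

    -- With x = s U Zᵉ and y = t V Zᶠ the scalars cancel, and [x, y] = U · Zᵉ V Z⁻ᵉ · Zᶠ U⁻¹ Z⁻ᶠ · V⁻¹
    -- is a product of elements of Q₈ because Z normalises Q₈.
    commutator-of-normal-forms : ∀ {x x' y y' s t U V} e f → InGL2 x → InGL2 y → InQ8 U → InQ8 V →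
                                 x ≈M (⟨ s ⟩ · (U · Z ^ e)) → y ≈M (⟨ t ⟩ · (V · Z ^ f)) →
                                 (x · x') ≈M I → (y · y') ≈M I → InQ8 (((x · y) · x') · y')
    commutator-of-normal-forms e f x∈GL y∈GL U∈Q8 V∈Q8 x≈ y≈ xx'≈I yy'≈I =
      let (U' , U'∈Q8 , U'U≈I , _) = InQ8-invertible U∈Q8
          (V' , V'∈Q8 , V'V≈I , _) = InQ8-invertible V∈Q8
          (s⁻¹ , s⁻¹s≈1) = invertible-scalar-factor x∈GL x≈
          (t⁻¹ , t⁻¹t≈1) = invertible-scalar-factor y∈GL y≈
          (V₁ , V₁∈Q8 , ZᵉV≈V₁Zᵉ) = Zⁿ-normalises-Q8 e V∈Q8
          (U₁ , U₁∈Q8 , ZᶠU'≈U₁Zᶠ) = Zⁿ-normalises-Q8 f U'∈Q8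
          x'≈ = scaled-inverse s⁻¹s≈1 U'U≈I (^-inverse Z'Z≈I e) x≈ xx'≈I
          y'≈ = scaled-inverse t⁻¹t≈1 V'V≈I (^-inverse Z'Z≈I f) y≈ yy'≈I
      in InQ8-resp (M.sym (M.trans (scaled-commutator x≈ y≈ x'≈ y'≈ s⁻¹s≈1 t⁻¹t≈1)
                                   (twisted-commutator ZᵉV≈V₁Zᵉ ZᶠU'≈U₁Zᶠ (^-comm Z e f) (^-inverse ZZ'≈I e) (^-inverse ZZ'≈I f))))
                   (InQ8-· U∈Q8 (InQ8-· V₁∈Q8 (InQ8-· U₁∈Q8 V'∈Q8)))

    [G,G]⊆Q8 : ∀ {m} → Comm G m → InQ8 m
    [G,G]⊆Q8 (gen x∈G _ y∈G _ xx'≈I yy'≈I) =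
      let (s , U , e , U∈Q8 , x≈) = normal-form x∈G
          (t , V , f , V∈Q8 , y≈) = normal-form y∈G
      in commutator-of-normal-forms e f (inGL x∈G) (inGL y∈G) U∈Q8 V∈Q8 x≈ y≈ xx'≈I yy'≈I
    [G,G]⊆Q8 one               = InQ8-I
    [G,G]⊆Q8 (mul m∈ n∈)       = InQ8-· ([G,G]⊆Q8 m∈) ([G,G]⊆Q8 n∈)
    [G,G]⊆Q8 (inv m∈ mn≈I)     = InQ8-inverse ([G,G]⊆Q8 m∈) mn≈I
    [G,G]⊆Q8 (resp m≈n m∈)     = InQ8-resp m≈n ([G,G]⊆Q8 m∈)

    trace-image⊆0±2 : ∀ {t} → InTraceImageComm G t → In0±2 t
    trace-image⊆0±2 (m , m∈[G,G] , tr≈t) = In0±2-resp tr≈t (InQ8-trace tr-i tr-j tr-ij ([G,G]⊆Q8 m∈[G,G]))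
      where
      In0±2-resp : ∀ {u v} → u ≈ v → In0±2 u → In0±2 v
      In0±2-resp u≈v = Sum.map (trans (sym u≈v)) (Sum.map (trans (sym u≈v)) (trans (sym u≈v)))

    0±2⊆trace-image : ∀ {t} → In0±2 t → InTraceImageComm G t
    0±2⊆trace-image (inj₁ t≈0)         = X , X∈[G,G] , trans tr-X (sym t≈0)
    0±2⊆trace-image (inj₂ (inj₁ t≈2))  = I , one , sym t≈2
    0±2⊆trace-image (inj₂ (inj₂ t≈-2)) = X · X , mul X∈[G,G] X∈[G,G] , trans (tr-cong X²≈-I) (trans (-‿+-comm 1# 1#) (sym t≈-2))
      where open import Algebra.Properties.Ring ring using (-‿+-comm)

lemma2p20 : ∀ {c ℓ p} (k : CommutativeRing c ℓ) → IsField k → IsFinite k → OddChar k →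
            (G : Matrices.M2 k → Set p) → Matrices.IsSubgroupGL2 k G → ImageInPGL2IsA4 k G →
            ∀ t → Matrices.InTraceImageComm k G t ⇔ Matrices.In0±2 k t
lemma2p20 k field' _ odd G G-subgroup G/scalars≅A4 t =
  let (Z , Z↦z) = ↦-surjective (from-yes (inA4? z))
      (T , T↦q) = ↦-surjective (from-yes (inA4? q))
      (Z' , Z'∈G , ZZ'≈I) = inverse (proj₁ Z↦z)
      (T' , T'∈G , TT'≈I) = inverse (proj₁ T↦q)
  in mk⇔ (trace-image⊆0±2 Z↦z Z'∈G ZZ'≈I T↦q T'∈G TT'≈I) (0±2⊆trace-image Z↦z Z'∈G ZZ'≈I T↦q T'∈G TT'≈I)
  where
  open Lifts k G-subgroup G/scalars≅A4
  open A4 using (z; q; inA4?)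
  open Matrices.IsSubgroupGL2 G-subgroup using () renaming (inv to inverse)
  open CommutatorSubgroup k field' odd G-subgroup G/scalars≅A4
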